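{- For every $n\geq 5$ and every $n$-dimensional restricted HL-graph $G^n\in RHL_n$, $fsmp(G^n)=fmp(G^n)=n$.
   Context: For graphs $G_0,G_1$ with $|V(G_0)|=|V(G_1)|$ and a bijection $\phi:V(G_0)\to V(G_1)$, $G_0\oplus_\phi G_1$ is the graph with vertex set $V(G_0)\cup V(G_1)$ (disjoint) and edge set $E(G_0)\cup E(G_1)\cup\{v\phi(v):v\in V(G_0)\}$. Let $G(8,4)$ be the graph with vertex set $\{0,\dots,7\}$ in which $u,v$ are adjacent iff $u-v\equiv \pm1$ or $4 \pmod 8$. Define $RHL_0=\{K_1\}$, $RHL_1=\{K_2\}$, $RHL_2=\{C_4\}$, $RHL_3=\{G(8,4)\}$ and, for $n\geq 4$, $RHL_n=\{G_0\oplus_\phi G_1: G_0,G_1\in RHL_{n-1},\ \phi \text{ a bijection } V(G_0)\to V(G_1)\}$. A fractional perfect matching of $G$ is $g:E(G)\to[0,1]$ with $\sum_{e\ni v}g(e)=1$ for all $v$. $fmp(G)$ (resp. $fsmp(G)$) is the minimum size of a set $F\subseteq E(G)$ (resp. $F\subseteq V(G)\cup E(G)$) whose deletion (vertices with incident edges, and edges) leaves a graph with no fractional perfect matching.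
   Formalization: The fractional perfect matchings of each graph left after deletion take rational values in $[0,1]$. -}

module Defs where

open import Data.Nat as ℕ using (ℕ; zero; suc; _%_)
open import Data.Bool using (Bool; true; false; _∨_; T; not)
open import Data.Bool.ListAction using (any)
open import Data.Fin using (Fin; toℕ; _↑ˡ_; _↑ʳ_; splitAt; _<_)
open import Data.Fin.Properties using (_≟_)
open import Data.Fin.Permutation using (Permutation′; _⟨$⟩ʳ_)
open import Data.Sum using (_⊎_; inj₁; inj₂)
open import Data.Product using (Σ; Σ-syntax; ∃; ∃-syntax; _×_; _,_)
open import Data.List using (List; length; allFin; foldr; map)
open import Data.List.Membership.Propositional using (_∈_)
open import Data.List.Relation.Unary.Any using (Any)
open import Data.List.Relation.Unary.All using (All)
open import Data.List.Relation.Unary.Unique.Propositional using (Unique)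
open import Data.Rational using (ℚ; 0ℚ; 1ℚ; _+_; _≤_)
open import Relation.Nullary using (¬_; ⌊_⌋)
open import Relation.Binary.PropositionalEquality using (_≡_; _≢_)

Graph : ℕ → Set
Graph N = Fin N → Fin N → Bool

K1 : Graph 1
K1 _ _ = false

K2 : Graph 2
K2 u v = not ⌊ toℕ u ℕ.≟ toℕ v ⌋

-- circulant adjacency on Z_m: u ~ v iff (u - v) mod m ∈ ds
circ : (m : ℕ) → List ℕ → Graph m
circ m ds u v = any (λ d → ⌊ ((toℕ u ℕ.+ m ℕ.∸ toℕ v) % suc (m ℕ.∸ 1)) ℕ.≟ d ⌋) ds
  where import Data.List

C4 : Graph 4
C4 = circ 4 (1 Data.List.∷ 3 Data.List.∷ Data.List.[])
  where import Data.List

G84 : Graph 8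
G84 = circ 8 (1 Data.List.∷ 7 Data.List.∷ 4 Data.List.∷ Data.List.[])
  where import Data.List

-- G0 ⊕_φ G1 : vertices of G0 are i ↑ˡ k, vertices of G1 are k ↑ʳ j
_⊕[_]_ : ∀ {k} → Graph k → Permutation′ k → Graph k → Graph (k ℕ.+ k)
_⊕[_]_ {k} G0 φ G1 a b with splitAt k a | splitAt k b
... | inj₁ x | inj₁ y = G0 x y
... | inj₂ x | inj₂ y = G1 x y
... | inj₁ x | inj₂ y = ⌊ (φ ⟨$⟩ʳ x) ≟ y ⌋
... | inj₂ y | inj₁ x = ⌊ (φ ⟨$⟩ʳ x) ≟ y ⌋

data RHL : ℕ → (N : ℕ) → Graph N → Set where
  rhl0 : RHL 0 1 K1
  rhl1 : RHL 1 2 K2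
  rhl2 : RHL 2 4 C4
  rhl3 : RHL 3 8 G84
  rhlS : ∀ {m k G0 G1} → 3 ℕ.≤ m → RHL m k G0 → RHL m k G1 →
         (φ : Permutation′ k) → RHL (suc m) (k ℕ.+ k) (G0 ⊕[ φ ] G1)

Edge : ∀ {N} → Graph N → Set
Edge {N} G = Σ[ p ∈ Fin N × Fin N ] (let (u , v) = p in (u < v) × T (G u v))

Elem : ∀ {N} → Graph N → Set
Elem {N} G = Fin N ⊎ Edge G

IsEdgeElem : ∀ {N} {G : Graph N} → Elem G → Set
IsEdgeElem (inj₁ _) = Data.Empty.⊥
  where import Data.Empty
IsEdgeElem (inj₂ _) = Data.Unit.⊤
  where import Data.Unit

ElemIsEdge : ∀ {N} {G : Graph N} → Elem G → Fin N → Fin N → Set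
ElemIsEdge (inj₁ _) u v = Data.Empty.⊥
  where import Data.Empty
ElemIsEdge (inj₂ ((a , b) , _)) u v = (a ≡ u × b ≡ v) ⊎ (a ≡ v × b ≡ u)

module _ {N : ℕ} (G : Graph N) (F : List (Elem G)) where

  VertexDeleted : Fin N → Set
  VertexDeleted v = inj₁ v ∈ F

  EdgeDeleted : Fin N → Fin N → Set
  EdgeDeleted u v = Any (λ x → ElemIsEdge x u v) F

  RemEdge : Fin N → Fin N → Set
  RemEdge u v = T (G u v) × ¬ VertexDeleted u × ¬ VertexDeleted v × ¬ EdgeDeleted u v

  Σℚ : (Fin N → ℚ) → ℚ
  Σℚ f = foldr _+_ 0ℚ (map f (allFin N))

  -- G - F has a fractional perfect matching.  An edge function g : E(G-F) → [0,1]
  -- is encoded as a symmetric g : Fin N → Fin N → ℚ supported on E(G-F).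
  HasFPM : Set
  HasFPM = Σ[ g ∈ (Fin N → Fin N → ℚ) ]
      (∀ u v → g u v ≡ g v u)
    × (∀ u v → g u v ≢ 0ℚ → RemEdge u v)
    × (∀ u v → 0ℚ ≤ g u v × g u v ≤ 1ℚ)
    × (∀ v → ¬ VertexDeleted v → Σℚ (g v) ≡ 1ℚ)

IsFmp : ∀ {N} → Graph N → ℕ → Set
IsFmp G k =
    (Σ[ F ∈ List (Elem G) ] (All IsEdgeElem F × Unique F × length F ≡ k × ¬ HasFPM G F))
  × (∀ (F : List (Elem G)) → All IsEdgeElem F → Unique F → length F ℕ.< k → HasFPM G F)

IsFsmp : ∀ {N} → Graph N → ℕ → Set
IsFsmp G k =
    (Σ[ F ∈ List (Elem G) ] (Unique F × length F ≡ k × ¬ HasFPM G F))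
  × (∀ (F : List (Elem G)) → Unique F → length F ℕ.< k → HasFPM G F)

-- Every graph of RHL_n is n-regular, so deleting the n edges at one vertex isolates it and
-- fsmp, fmp ≤ n.  For the converse call G m-robust if G − F has a fractional perfect matching
-- whenever |F| ≤ m − 2, or |F| = m − 1 and F does not contain exactly one vertex.  G(8,4) is
-- 3-robust by explicit matchings (its three perfect matchings partition the edges, so two
-- faulty edges miss one of them), and G₀ ⊕_φ G₁ is (m + 1)-robust when G₀, G₁ are m-robust:
-- split the faults into those of G₀, of G₁ and of the cross edges.  If both halves keep few
-- faults, matchings of the halves glue.  Otherwise the heavier half, say G₀, carries all but
-- at most one fault; reinstate one faulty element of G₀ and match G₀ fractionally, then
-- delete it again by moving its weight across the cross edges: the weight g(x, w) of a
-- reinstated vertex x goes onto a matching of G₁ − φ(w), that of a reinstated edge uv onto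
-- matchings of G₁ − {φ(u), φ(v)} and G₁.  For m ≥ 4 the same construction handles every set
-- of m faults, which gives fsmp, fmp ≥ n for n ≥ 5.

module Submission where

import Algebra.Bundles

module FinSum {c ℓ} (M : Algebra.Bundles.CommutativeMonoid c ℓ) where

  open import Data.Bool using (if_then_else_)
  open import Data.Nat using (zero; suc)
  open import Data.Fin using (Fin; zero; suc; splitAt)
  open import Data.Fin.Properties using (_≟_)
  open import Data.Sum using (_⊎_; inj₁; inj₂; map₁)
  open import Relation.Nullary using (yes; no; ⌊_⌋)
  open import Relation.Binary.PropositionalEquality using (_≡_; refl)
  open import Function using (_∘_)
  open Algebra.Bundles.CommutativeMonoid M
    using (Carrier; _≈_; setoid; sym)
    renaming (_∙_ to _+_; ε to 0#; identityˡ to +-identityˡ; identityʳ to +-identityʳ; assoc to +-assoc; ∙-congˡ to +-congˡ)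
  open import Algebra.Properties.CommutativeMonoid.Sum M public using (sum; sum-cong-≗; sum-replicate-zero)
  open import Relation.Binary.Reasoning.Setoid setoid

  if_≐_then_else_ : ∀ {a} {A : Set a} {n} → Fin n → Fin n → A → A → A
  if i ≐ a then x else y = if ⌊ i ≟ a ⌋ then x else y

  sum-splitAt : ∀ m {n} (h : Fin m ⊎ Fin n → Carrier) → sum (h ∘ splitAt m) ≈ sum (h ∘ inj₁) + sum (h ∘ inj₂)
  sum-splitAt zero h = sym (+-identityˡ _)
  sum-splitAt (suc m) h = begin
    h (inj₁ zero) + sum (h ∘ map₁ suc ∘ splitAt m)              ≈⟨ +-congˡ (sum-splitAt m (h ∘ map₁ suc)) ⟩
    h (inj₁ zero) + (sum (h ∘ inj₁ ∘ suc) + sum (h ∘ inj₂))      ≈⟨ sym (+-assoc _ _ _) ⟩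
    (h (inj₁ zero) + sum (h ∘ inj₁ ∘ suc)) + sum (h ∘ inj₂)      ∎

  sum-single : ∀ {n} (a : Fin n) (f : Fin n → Carrier) → sum (λ i → if i ≐ a then f i else 0#) ≈ f a
  sum-single {suc n} zero f = begin
    f zero + sum (λ i → if suc i ≐ zero then f (suc i) else 0#)  ≡⟨⟩
    f zero + sum {n} (λ _ → 0#)                                   ≈⟨ +-congˡ (sum-replicate-zero n) ⟩
    f zero + 0#                                                   ≈⟨ +-identityʳ _ ⟩
    f zero                                                        ∎
  sum-single {suc n} (suc a) f = begin
    0# + sum (λ i → if suc i ≐ suc a then f (suc i) else 0#)     ≈⟨ +-identityˡ _ ⟩
    sum (λ i → if suc i ≐ suc a then f (suc i) else 0#)          ≡⟨ sum-cong-≗ shift ⟩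
    sum (λ i → if i ≐ a then f (suc i) else 0#)                  ≈⟨ sum-single a (f ∘ suc) ⟩
    f (suc a)                                                     ∎
    where
    shift : ∀ i → (if suc i ≐ suc a then f (suc i) else 0#) ≡ (if i ≐ a then f (suc i) else 0#)
    shift i with i ≟ a
    ... | yes _ = refl
    ... | no _ = refl

open import Relation.Binary.PropositionalEquality
open import Data.Nat using (ℕ)
open import Data.Fin using (Fin)
open import Data.Fin.Permutation using (Permutation′)
open import Data.Bool using (Bool; false)
open import Defs using (Graph)

module Rational where

  open import Algebra.Bundles using (Ring)
  open import Data.Nat using (zero; suc)
  open import Data.Fin using (Fin; zero; suc)
  open import Data.Fin.Properties using (_≟_)
  open import Data.Sum using (_⊎_; inj₁; inj₂)
  open import Data.Product using (_×_; ∃-syntax; _,_)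
  open import Data.List using (foldr; map; tabulate; allFin)
  open import Data.List.Properties using (map-tabulate)
  open import Data.Rational using (ℚ; 0ℚ; _+_; _*_; _-_; -_; _≤_; nonNegative)
  open import Data.Rational.Properties
    using (+-*-ring; +-0-commutativeMonoid; +-identityˡ; +-identityʳ; +-assoc; +-inverseʳ; +-mono-≤; +-monoʳ-≤; ≤-refl;
           *-zeroʳ; *-monoˡ-≤-nonNeg)
    renaming (_≟_ to _≟ℚ_)
  open import Relation.Nullary using (yes; no)
  open import Relation.Binary.PropositionalEquality
  open import Function using (_∘_; id)
  open import Data.Empty using (⊥-elim)

  open FinSum +-0-commutativeMonoid public using (sum; sum-cong-≗; sum-splitAt; sum-single; if_≐_then_else_)
  open import Algebra.Properties.Semiring.Sum (Ring.semiring +-*-ring) public using (∑-distrib-+; ∑-comm; *-distribˡ-sum)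
  open import Algebra.Properties.Semiring.Sum (Ring.semiring +-*-ring) using (sum-replicate-zero)

  sum-zero : ∀ n → sum {n} (λ _ → 0ℚ) ≡ 0ℚ
  sum-zero = sum-replicate-zero

  foldr-allFin : ∀ {n} (f : Fin n → ℚ) → foldr _+_ 0ℚ (map f (allFin n)) ≡ sum f
  foldr-allFin {n} f = trans (cong (foldr _+_ 0ℚ) (map-tabulate id f)) (foldr-tabulate f)
    where
    foldr-tabulate : ∀ {n} (f : Fin n → ℚ) → foldr _+_ 0ℚ (tabulate f) ≡ sum f
    foldr-tabulate {zero} f = refl
    foldr-tabulate {suc n} f = cong (f zero +_) (foldr-tabulate (f ∘ suc))

  sum-nonneg : ∀ {n} (f : Fin n → ℚ) → (∀ i → 0ℚ ≤ f i) → 0ℚ ≤ sum f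
  sum-nonneg {zero} f f≥0 = ≤-refl
  sum-nonneg {suc n} f f≥0 = subst (_≤ sum f) (+-identityˡ 0ℚ) (+-mono-≤ (f≥0 zero) (sum-nonneg (f ∘ suc) (f≥0 ∘ suc)))

  term≤sum : ∀ {n} (f : Fin n → ℚ) → (∀ i → 0ℚ ≤ f i) → ∀ a → f a ≤ sum f
  term≤sum {suc n} f f≥0 zero =
    subst (_≤ sum f) (+-identityʳ (f zero)) (+-monoʳ-≤ (f zero) (sum-nonneg (f ∘ suc) (f≥0 ∘ suc)))
  term≤sum {suc n} f f≥0 (suc a) =
    subst (_≤ sum f) (+-identityˡ (f (suc a))) (+-mono-≤ (f≥0 zero) (term≤sum (f ∘ suc) (f≥0 ∘ suc) a))

  sum≢0⇒term≢0 : ∀ {n} (f : Fin n → ℚ) → sum f ≢ 0ℚ → ∃[ i ] f i ≢ 0ℚ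
  sum≢0⇒term≢0 {zero} f ∑f≢0 = ⊥-elim (∑f≢0 refl)
  sum≢0⇒term≢0 {suc n} f ∑f≢0 with f zero ≟ℚ 0ℚ
  ... | no f₀≢0 = zero , f₀≢0
  ... | yes f₀≡0 with sum≢0⇒term≢0 (f ∘ suc) (λ ∑≡0 → ∑f≢0 (trans (cong₂ _+_ f₀≡0 ∑≡0) (+-identityˡ 0ℚ)))
  ... | i , fᵢ≢0 = suc i , fᵢ≢0

  sum-except : ∀ {n} (a : Fin n) (f : Fin n → ℚ) → sum (λ i → if i ≐ a then 0ℚ else f i) ≡ sum f - f a
  sum-except {n} a f = begin
    sum others                            ≡⟨ sym (+-identityʳ _) ⟩
    sum others + 0ℚ                       ≡⟨ cong (sum others +_) (sym (+-inverseʳ (f a))) ⟩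
    sum others + (f a - f a)              ≡⟨ sym (+-assoc (sum others) (f a) (- f a)) ⟩
    (sum others + f a) - f a              ≡⟨ cong (λ t → (sum others + t) - f a) (sym (sum-single a f)) ⟩
    (sum others + sum single) - f a       ≡⟨ cong (_- f a) (sym (∑-distrib-+ others single)) ⟩
    sum (λ i → others i + single i) - f a ≡⟨ cong (_- f a) (sum-cong-≗ recombine) ⟩
    sum f - f a                           ∎
    where
    open ≡-Reasoning
    others single : Fin n → ℚ
    others i = if i ≐ a then 0ℚ else f i
    single i = if i ≐ a then f i else 0ℚ
    recombine : ∀ i → others i + single i ≡ f i
    recombine i with i ≟ a
    ... | yes _ = +-identityˡ _
    ... | no _ = +-identityʳ _

  *-nonneg : ∀ {a b} → 0ℚ ≤ a → 0ℚ ≤ b → 0ℚ ≤ a * b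
  *-nonneg {a} {b} 0≤a 0≤b = subst (_≤ a * b) (*-zeroʳ a) (*-monoˡ-≤-nonNeg a {{nonNegative 0≤a}} 0≤b)

  *≢0⇒≢0 : ∀ a {b} → a * b ≢ 0ℚ → b ≢ 0ℚ
  *≢0⇒≢0 a ab≢0 b≡0 = ab≢0 (trans (cong (a *_) b≡0) (*-zeroʳ a))

  +≢0 : ∀ a b → a + b ≢ 0ℚ → a ≢ 0ℚ ⊎ b ≢ 0ℚ
  +≢0 a b a+b≢0 with a ≟ℚ 0ℚ
  ... | no a≢0 = inj₁ a≢0
  ... | yes a≡0 = inj₂ (λ b≡0 → a+b≢0 (trans (cong₂ _+_ a≡0 b≡0) (+-identityˡ 0ℚ)))

  if-nonneg : ∀ {n} {i a : Fin n} {x y : ℚ} → 0ℚ ≤ x → 0ℚ ≤ y → 0ℚ ≤ (if i ≐ a then x else y)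
  if-nonneg {i = i} {a} 0≤x 0≤y with i ≟ a
  ... | yes _ = 0≤x
  ... | no _ = 0≤y

  if≢0 : ∀ {n} {i a : Fin n} {x : ℚ} → (if i ≐ a then x else 0ℚ) ≢ 0ℚ → i ≡ a × x ≢ 0ℚ
  if≢0 {i = i} {a} ≢0 with i ≟ a
  ... | yes i≡a = i≡a , ≢0
  ... | no _ = ⊥-elim (≢0 refl)

module Matching where

  open import Data.Nat using (ℕ)
  open import Data.Fin using (Fin)
  open import Data.Bool using (Bool; T)
  open import Data.Sum using (_⊎_; inj₁; inj₂; [_,_]′)
  open import Data.Product using (_×_; _,_; proj₁; proj₂)
  open import Data.Rational using (ℚ; 0ℚ; 1ℚ; _≤_)
  open import Data.Rational.Properties using (nonNegative⁻¹) renaming (_≟_ to _≟ℚ_)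
  open import Relation.Nullary using (¬_; yes; no)
  open import Relation.Binary.PropositionalEquality
  open import Function using (_∘_; id; _⇔_; Equivalence)
  open import Data.Empty using (⊥-elim)
  open Rational

  record Deletion (V : Set) : Set₁ where
    field
      vertex : V → Set
      edge : V → V → Set
      edge-sym : ∀ {x y} → edge x y → edge y x

  open Deletion public

  infixl 6 _∘ᵈ_ _+ᵛ_ _+ᵉ_
  infix 4 _≼_

  _∘ᵈ_ : ∀ {V V′ : Set} → Deletion V′ → (V → V′) → Deletion V
  Δ ∘ᵈ σ = record { vertex = vertex Δ ∘ σ ; edge = λ x y → edge Δ (σ x) (σ y) ; edge-sym = edge-sym Δ }

  _+ᵛ_ : ∀ {V : Set} → Deletion V → V → Deletion V
  Δ +ᵛ y = record { vertex = λ x → x ≡ y ⊎ vertex Δ x ; edge = edge Δ ; edge-sym = edge-sym Δ }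

  _+ᵉ_ : ∀ {V : Set} → Deletion V → V × V → Deletion V
  _+ᵉ_ {V} Δ (u , v) = record { vertex = vertex Δ ; edge = edge′ ; edge-sym = sym′ }
    where
    edge′ : V → V → Set
    edge′ x y = edge Δ x y ⊎ (x ≡ u × y ≡ v) ⊎ (x ≡ v × y ≡ u)
    sym′ : ∀ {x y} → edge′ x y → edge′ y x
    sym′ (inj₁ e) = inj₁ (edge-sym Δ e)
    sym′ (inj₂ (inj₁ (x≡u , y≡v))) = inj₂ (inj₂ (y≡v , x≡u))
    sym′ (inj₂ (inj₂ (x≡v , y≡u))) = inj₂ (inj₁ (y≡u , x≡v))

  record _≼_ {V : Set} (Δ Δ′ : Deletion V) : Set where
    field
      same-vertices : ∀ x → vertex Δ x ⇔ vertex Δ′ x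
      fewer-edges : ∀ {x y} → edge Δ x y → edge Δ′ x y

  ∘ᵈ-mono : ∀ {V V′ : Set} {Δ Δ′ : Deletion V′} (τ : V → V′) → Δ ≼ Δ′ → Δ ∘ᵈ τ ≼ Δ′ ∘ᵈ τ
  ∘ᵈ-mono τ Δ≼Δ′ = record { same-vertices = same-vertices ∘ τ ; fewer-edges = fewer-edges }
    where open _≼_ Δ≼Δ′

  Available : ∀ {V : Set} → (V → V → Bool) → Deletion V → V → V → Set
  Available G Δ x y = T (G x y) × ¬ vertex Δ x × ¬ vertex Δ y × ¬ edge Δ x y

  record FPM {V : Set} (∑ : (V → ℚ) → ℚ) (G : V → V → Bool) (Δ : Deletion V) : Set where
    field
      weight : V → V → ℚ
      weight-sym : ∀ x y → weight x y ≡ weight y x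
      weight-supp : ∀ x y → weight x y ≢ 0ℚ → Available G Δ x y
      weight-nonneg : ∀ x y → 0ℚ ≤ weight x y
      saturated : ∀ x → ¬ vertex Δ x → ∑ (weight x) ≡ 1ℚ

  open FPM public

  pullback : ∀ {V V′ : Set} {∑ : (V → ℚ) → ℚ} {∑′ : (V′ → ℚ) → ℚ} {G : V → V → Bool} {G′ : V′ → V′ → Bool}
      {Δ : Deletion V} {Δ′ : Deletion V′} (σ : V → V′)
    → (∀ h → ∑ (h ∘ σ) ≡ ∑′ h)
    → (∀ x y → T (G′ (σ x) (σ y)) → T (G x y))
    → Δ ≼ Δ′ ∘ᵈ σ
    → FPM ∑′ G′ Δ′ → FPM ∑ G Δ
  pullback {G = G} {Δ = Δ} σ ∑σ Gσ Δ≼Δ′σ M = record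
    { weight = λ x y → weight M (σ x) (σ y)
    ; weight-sym = λ x y → weight-sym M (σ x) (σ y)
    ; weight-supp = supp
    ; weight-nonneg = λ x y → weight-nonneg M (σ x) (σ y)
    ; saturated = λ x x∉Δ → trans (∑σ (weight M (σ x))) (saturated M (σ x) (x∉Δ ∘ Equivalence.from (same-vertices x)))
    }
    where
    open _≼_ Δ≼Δ′σ
    supp : ∀ x y → weight M (σ x) (σ y) ≢ 0ℚ → Available G Δ x y
    supp x y w≢0 with weight-supp M (σ x) (σ y) w≢0
    ... | xy∈G′ , x∉Δ′ , y∉Δ′ , xy∉Δ′ =
      Gσ x y xy∈G′ , x∉Δ′ ∘ Equivalence.to (same-vertices x) , y∉Δ′ ∘ Equivalence.to (same-vertices y) , xy∉Δ′ ∘ fewer-edges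

  weaken : ∀ {V : Set} {∑ : (V → ℚ) → ℚ} {G : V → V → Bool} {Δ Δ′ : Deletion V} → Δ ≼ Δ′ → FPM ∑ G Δ′ → FPM ∑ G Δ
  weaken = pullback id (λ _ → refl) (λ _ _ xy∈G → xy∈G)

  delete-unused-edges : ∀ {V : Set} {∑ : (V → ℚ) → ℚ} {G : V → V → Bool} {Δ Δ′ : Deletion V} (M : FPM ∑ G Δ)
    → (∀ x → vertex Δ′ x ⇔ vertex Δ x) → (∀ {x y} → edge Δ′ x y → edge Δ x y ⊎ weight M x y ≡ 0ℚ) → FPM ∑ G Δ′
  delete-unused-edges {G = G} {Δ} {Δ′} M same-vertices unused = record
    { weight = weight M ; weight-sym = weight-sym M ; weight-supp = supp
    ; weight-nonneg = weight-nonneg M ; saturated = λ x x∉Δ′ → saturated M x (x∉Δ′ ∘ Equivalence.from (same-vertices x)) }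
    where
    supp : ∀ x y → weight M x y ≢ 0ℚ → Available G Δ′ x y
    supp x y w≢0 with weight-supp M x y w≢0
    ... | xy∈G , x∉Δ , y∉Δ , xy∉Δ = xy∈G , x∉Δ ∘ Equivalence.to (same-vertices x) , y∉Δ ∘ Equivalence.to (same-vertices y) ,
      λ xy∈Δ′ → [ xy∉Δ , w≢0 ]′ (unused xy∈Δ′)

  module _ {N : ℕ} {G : Fin N → Fin N → Bool} {Δ : Deletion (Fin N)} (M : FPM sum G Δ) where

    weight-at-deleted : ∀ {x} → vertex Δ x → ∀ y → weight M x y ≡ 0ℚ
    weight-at-deleted {x} x∈Δ y with weight M x y ≟ℚ 0ℚ
    ... | yes w≡0 = w≡0
    ... | no w≢0 = ⊥-elim (proj₁ (proj₂ (weight-supp M x y w≢0)) x∈Δ)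

    sum-at-deleted : ∀ {x} → vertex Δ x → sum (weight M x) ≡ 0ℚ
    sum-at-deleted x∈Δ = trans (sum-cong-≗ (weight-at-deleted x∈Δ)) (sum-zero N)

    weight≤1 : ∀ x y → weight M x y ≤ 1ℚ
    weight≤1 x y with weight M x y ≟ℚ 0ℚ
    ... | yes w≡0 = subst (_≤ 1ℚ) (sym w≡0) (nonNegative⁻¹ 1ℚ)
    ... | no w≢0 = subst (weight M x y ≤_) (saturated M x (proj₁ (proj₂ (weight-supp M x y w≢0))))
                     (term≤sum (weight M x) (weight-nonneg M x) y)

module Faults where

  open import Data.Nat using (ℕ; suc; _<_; _≤_; s≤s; z≤n)
  open import Data.Nat.Properties using (≤-trans; ≤-reflexive; suc-injective; 0≢1+n; 1+n≢0)
  open import Data.Fin using (Fin)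
  open import Data.Bool using (Bool)
  open import Data.Sum using (_⊎_; inj₁; inj₂)
  import Data.Sum as Sum
  open import Data.Product using (_×_; _,_; Σ-syntax)
  open import Data.List using (List; []; _∷_; length)
  open import Data.List.Relation.Unary.Any using (here; there)
  open import Data.List.Membership.Propositional using (_∈_)
  open import Data.List.Relation.Binary.Permutation.Propositional using (_↭_; ↭-refl; ↭-prep; ↭-swap; ↭-trans; ↭-sym)
  open import Data.List.Relation.Binary.Permutation.Propositional.Properties using (∈-resp-↭)
  open import Data.Sum.Properties using (inj₁-injective)
  open import Relation.Nullary using (¬_)
  open import Relation.Binary.PropositionalEquality
  open import Function using (_∘_; mk⇔; Equivalence)
  open import Function.Construct.Composition using (_⇔-∘_)
  open import Function.Construct.Symmetry using (⇔-sym)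
  open Matching
  open Rational using (sum)

  Fault : Set → Set
  Fault V = V ⊎ (V × V)

  deletion : ∀ {V : Set} → List (Fault V) → Deletion V
  deletion D = record
    { vertex = λ x → inj₁ x ∈ D ; edge = λ x y → inj₂ (x , y) ∈ D ⊎ inj₂ (y , x) ∈ D ; edge-sym = Sum.swap }

  countVertices : ∀ {V : Set} → List (Fault V) → ℕ
  countVertices [] = 0
  countVertices (inj₁ _ ∷ D) = suc (countVertices D)
  countVertices (inj₂ _ ∷ D) = countVertices D

  Robust : ℕ → ∀ {N} → (Fin N → Fin N → Bool) → Set
  Robust m G = ∀ D → length D < m → suc (length D) < m ⊎ countVertices D ≢ 1 → FPM sum G (deletion D)

  -- the fault sets of size at most m that the join of two m-robust graphs survives
  Tolerable : ∀ {V : Set} → ℕ → List (Fault V) → Set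
  Tolerable m D = length D < m ⊎ countVertices D ≢ 1 ⊎ 4 ≤ m

  Tolerable-resp : ∀ {V V′ : Set} {m} {D : List (Fault V)} {D′ : List (Fault V′)}
    → length D ≡ length D′ → countVertices D ≡ countVertices D′ → Tolerable m D → Tolerable m D′
  Tolerable-resp length≡ count≡ (inj₁ l<m) = inj₁ (subst (_< _) length≡ l<m)
  Tolerable-resp length≡ count≡ (inj₂ (inj₁ count≢1)) = inj₂ (inj₁ (count≢1 ∘ trans count≡))
  Tolerable-resp length≡ count≡ (inj₂ (inj₂ 4≤m)) = inj₂ (inj₂ 4≤m)

  module _ {V : Set} where

    ≼-trans : ∀ {Δ Δ′ Δ″ : Deletion V} → Δ ≼ Δ′ → Δ′ ≼ Δ″ → Δ ≼ Δ″
    ≼-trans p q = record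
      { same-vertices = λ x → same-vertices q x ⇔-∘ same-vertices p x
      ; fewer-edges = fewer-edges q ∘ fewer-edges p }
      where open _≼_

    +ᵛ-mono : ∀ {Δ Δ′ : Deletion V} {y} → Δ ≼ Δ′ → Δ +ᵛ y ≼ Δ′ +ᵛ y
    +ᵛ-mono p = record
      { same-vertices = λ x → mk⇔ (Sum.map₂ (Equivalence.to (same-vertices p x))) (Sum.map₂ (Equivalence.from (same-vertices p x)))
      ; fewer-edges = fewer-edges p }
      where open _≼_

    deletion-↭ : ∀ {D D′ : List (Fault V)} → D ↭ D′ → deletion D ≼ deletion D′
    deletion-↭ D↭D′ = record
      { same-vertices = λ x → mk⇔ (∈-resp-↭ D↭D′) (∈-resp-↭ (↭-sym D↭D′))
      ; fewer-edges = Sum.map (∈-resp-↭ D↭D′) (∈-resp-↭ D↭D′) }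

    deletion-vertex∷ : ∀ {y} {D : List (Fault V)} → deletion (inj₁ y ∷ D) ≼ deletion D +ᵛ y
    deletion-vertex∷ = record
      { same-vertices = λ x → mk⇔ split (λ { (inj₁ refl) → here refl ; (inj₂ x∈D) → there x∈D })
      ; fewer-edges = Sum.map drop drop }
      where
      split : ∀ {x y D} → inj₁ x ∈ inj₁ y ∷ D → x ≡ y ⊎ inj₁ x ∈ D
      split (here eq) = inj₁ (inj₁-injective eq)
      split (there x∈D) = inj₂ x∈D
      drop : ∀ {e y D} → inj₂ e ∈ inj₁ y ∷ D → inj₂ e ∈ D
      drop (here ())
      drop (there e∈D) = e∈D

    deletion-+ᵛ : ∀ {y} {D : List (Fault V)} → deletion D +ᵛ y ≼ deletion (inj₁ y ∷ D)
    deletion-+ᵛ = record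
      { same-vertices = λ x → ⇔-sym (same-vertices deletion-vertex∷ x)
      ; fewer-edges = Sum.map there there }
      where open _≼_

    deletion-edge∷ : ∀ {u v} {D : List (Fault V)} → deletion (inj₂ (u , v) ∷ D) ≼ deletion D +ᵉ (u , v)
    deletion-edge∷ = record
      { same-vertices = λ x → mk⇔ (λ { (here ()) ; (there x∈D) → x∈D }) there
      ; fewer-edges = λ { (inj₁ (here refl)) → inj₂ (inj₁ (refl , refl)) ; (inj₁ (there e∈D)) → inj₁ (inj₁ e∈D)
                        ; (inj₂ (here refl)) → inj₂ (inj₂ (refl , refl)) ; (inj₂ (there e∈D)) → inj₁ (inj₂ e∈D) } }

    deletion-∷edge : ∀ {e} {D : List (Fault V)} → deletion D ≼ deletion (inj₂ e ∷ D)
    deletion-∷edge = record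
      { same-vertices = λ x → mk⇔ there (λ { (here ()) ; (there x∈D) → x∈D })
      ; fewer-edges = Sum.map there there }

    deletion-duplicate : ∀ {x} {D : List (Fault V)} → inj₁ x ∈ D → deletion (inj₁ x ∷ D) ≼ deletion D
    deletion-duplicate x∈D = record
      { same-vertices = λ y → mk⇔ (λ { (here refl) → x∈D ; (there y∈D) → y∈D }) there
      ; fewer-edges = Sum.map (λ { (there e∈D) → e∈D }) (λ { (there e∈D) → e∈D }) }

    no-vertex-faults : ∀ (D : List (Fault V)) → countVertices D ≡ 0 → ∀ {x} → ¬ inj₁ x ∈ D
    no-vertex-faults (inj₂ _ ∷ D) none (there x∈D) = no-vertex-faults D none x∈D

    extractVertex : ∀ (D : List (Fault V)) → 1 ≤ countVertices D →
      Σ[ x ∈ V ] Σ[ D′ ∈ List (Fault V) ] (D ↭ inj₁ x ∷ D′ × countVertices D ≡ suc (countVertices D′))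
    extractVertex (inj₁ x ∷ D) _ = x , D , ↭-refl , refl
    extractVertex (inj₂ e ∷ D) 1≤n with extractVertex D 1≤n
    ... | x , D′ , D↭ , count≡ = x , inj₂ e ∷ D′ , ↭-trans (↭-prep _ D↭) (↭-swap _ _ ↭-refl) , count≡

    extractEdge : ∀ (D : List (Fault V)) → countVertices D < length D →
      Σ[ e ∈ V × V ] Σ[ D′ ∈ List (Fault V) ] (D ↭ inj₂ e ∷ D′ × countVertices D ≡ countVertices D′)
    extractEdge (inj₂ e ∷ D) _ = e , D , ↭-refl , refl
    extractEdge (inj₁ x ∷ D) (s≤s n<l) with extractEdge D n<l
    ... | e , D′ , D↭ , count≡ = e , inj₁ x ∷ D′ , ↭-trans (↭-prep _ D↭) (↭-swap _ _ ↭-refl) , cong suc count≡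

    removable : ∀ (D : List (Fault V)) → 3 ≤ length D →
      Σ[ f ∈ Fault V ] Σ[ D′ ∈ List (Fault V) ] (D ↭ f ∷ D′ × countVertices D′ ≢ 1)
    removable D 3≤l with countVertices D in count≡
    ... | 0 with extractEdge D (subst (_< length D) (sym count≡) (≤-trans (s≤s z≤n) 3≤l))
    ...   | e , D′ , D↭ , count≡′ = inj₂ e , D′ , D↭ , subst (_≢ 1) (sym (trans (sym count≡′) count≡)) 0≢1+n
    removable D 3≤l | 1 with extractVertex D (≤-reflexive (sym count≡))
    ...   | x , D′ , D↭ , count≡′ = inj₁ x , D′ , D↭ , subst (_≢ 1) (sym (suc-injective (trans (sym count≡′) count≡))) 0≢1+n
    removable D 3≤l | 2 with extractEdge D (subst (_< length D) (sym count≡) 3≤l)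
    ...   | e , D′ , D↭ , count≡′ = inj₂ e , D′ , D↭ , subst (_≢ 1) (sym (trans (sym count≡′) count≡)) (1+n≢0 ∘ suc-injective)
    removable D 3≤l | suc (suc (suc n)) with extractVertex D (subst (1 ≤_) (sym count≡) (s≤s z≤n))
    ...   | x , D′ , D↭ , count≡′ = inj₁ x , D′ , D↭ , subst (_≢ 1) (sym (suc-injective (trans (sym count≡′) count≡))) (1+n≢0 ∘ suc-injective)

module SideFaults where

  open import Data.Nat using (ℕ; suc; _+_)
  import Data.Nat.Properties as ℕ
  open import Data.Sum using (_⊎_; inj₁; inj₂)
  import Data.Sum as Sum
  open import Data.Sum.Properties using (inj₁-injective; swap-involutive)
  open import Data.Product using (_×_; _,_; ∃-syntax)
  import Data.Product as Product
  open import Data.Maybe using (Maybe; just; nothing)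
  open import Data.List using (List; []; _∷_; length; map; mapMaybe)
  open import Data.List.Relation.Unary.Any using (here; there)
  open import Data.List.Membership.Propositional using (_∈_)
  open import Data.List.Membership.Propositional.Properties using (∈-map⁺; ∈-map⁻)
  open import Relation.Binary.PropositionalEquality
  open import Function using (_∘_; mk⇔; Injective)
  open Matching
  open Faults

  ∈-mapMaybe⁺ : ∀ {A B : Set} (f : A → Maybe B) {x y xs} → x ∈ xs → f x ≡ just y → y ∈ mapMaybe f xs
  ∈-mapMaybe⁺ f {xs = x ∷ xs} (here refl) fx≡y with f x | fx≡y
  ... | just _ | refl = here refl
  ∈-mapMaybe⁺ f {xs = x ∷ xs} (there x∈xs) fx≡y with f x
  ... | just _ = there (∈-mapMaybe⁺ f x∈xs fx≡y)
  ... | nothing = ∈-mapMaybe⁺ f x∈xs fx≡y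

  ∈-mapMaybe⁻ : ∀ {A B : Set} (f : A → Maybe B) {y} xs → y ∈ mapMaybe f xs → ∃[ x ] (x ∈ xs × f x ≡ just y)
  ∈-mapMaybe⁻ f (x ∷ xs) y∈ with f x in fx≡
  ∈-mapMaybe⁻ f (x ∷ xs) (here refl) | just _ = x , here refl , fx≡
  ∈-mapMaybe⁻ f (x ∷ xs) (there y∈) | just _ = Product.map₂ (Product.map₁ there) (∈-mapMaybe⁻ f xs y∈)
  ∈-mapMaybe⁻ f (x ∷ xs) y∈ | nothing = Product.map₂ (Product.map₁ there) (∈-mapMaybe⁻ f xs y∈)

  mapFault : ∀ {V V′ : Set} → (V → V′) → Fault V → Fault V′
  mapFault σ = Sum.map σ (Product.map σ σ)

  deletion-map : ∀ {V V′ : Set} (σ : V → V′) → Injective _≡_ _≡_ σ → (D : List (Fault V))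
    → deletion D ≼ deletion (map (mapFault σ) D) ∘ᵈ σ
  deletion-map σ σ-injective D = record
    { same-vertices = λ x → mk⇔ (∈-map⁺ (mapFault σ)) (from x)
    ; fewer-edges = Sum.map (∈-map⁺ (mapFault σ)) (∈-map⁺ (mapFault σ)) }
    where
    from : ∀ x → inj₁ (σ x) ∈ map (mapFault σ) D → inj₁ x ∈ D
    from x σx∈ with ∈-map⁻ (mapFault σ) σx∈
    ... | inj₁ x′ , x′∈D , σx≡σx′ = subst (λ z → inj₁ z ∈ D) (sym (σ-injective (inj₁-injective σx≡σx′))) x′∈D

  module _ {A B : Set} where

    swapFault : Fault (A ⊎ B) → Fault (B ⊎ A)
    swapFault = mapFault Sum.swap

    leftPart : Fault (A ⊎ B) → Maybe (Fault A)
    leftPart (inj₁ (inj₁ a)) = just (inj₁ a)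
    leftPart (inj₂ (inj₁ a , inj₁ a′)) = just (inj₂ (a , a′))
    leftPart _ = nothing

    crossPart : Fault (A ⊎ B) → Maybe (A × B)
    crossPart (inj₂ (inj₁ a , inj₂ b)) = just (a , b)
    crossPart (inj₂ (inj₂ b , inj₁ a)) = just (a , b)
    crossPart _ = nothing

    leftPart-vertex : ∀ f {a} → leftPart f ≡ just (inj₁ a) → f ≡ inj₁ (inj₁ a)
    leftPart-vertex (inj₁ (inj₁ a)) refl = refl
    leftPart-vertex (inj₁ (inj₂ b)) ()
    leftPart-vertex (inj₂ (inj₁ a , inj₁ a′)) ()
    leftPart-vertex (inj₂ (inj₁ a , inj₂ b)) ()
    leftPart-vertex (inj₂ (inj₂ b , _)) ()

    leftFaults : List (Fault (A ⊎ B)) → List (Fault A)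
    leftFaults = mapMaybe leftPart

    crossFaults : List (Fault (A ⊎ B)) → List (A × B)
    crossFaults = mapMaybe crossPart

    left-restriction : ∀ D → deletion D ∘ᵈ inj₁ ≼ deletion (leftFaults D)
    left-restriction D = record
      { same-vertices = λ a → mk⇔ (λ a∈D → ∈-mapMaybe⁺ leftPart a∈D refl) (from a)
      ; fewer-edges = Sum.map (λ e∈D → ∈-mapMaybe⁺ leftPart e∈D refl) (λ e∈D → ∈-mapMaybe⁺ leftPart e∈D refl) }
      where
      from : ∀ a → inj₁ a ∈ leftFaults D → inj₁ (inj₁ a) ∈ D
      from a a∈ with ∈-mapMaybe⁻ leftPart D a∈
      ... | f , f∈D , part≡ = subst (_∈ D) (leftPart-vertex f part≡) f∈D

    cross-deleted : ∀ D {a b} → edge (deletion D) (inj₁ a) (inj₂ b) → (a , b) ∈ crossFaults D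
    cross-deleted D (inj₁ ab∈D) = ∈-mapMaybe⁺ crossPart ab∈D refl
    cross-deleted D (inj₂ ba∈D) = ∈-mapMaybe⁺ crossPart ba∈D refl

  rightFaults : ∀ {A B : Set} → List (Fault (A ⊎ B)) → List (Fault B)
  rightFaults = leftFaults ∘ map swapFault

  swap-injective : ∀ {A B : Set} → Injective _≡_ _≡_ (Sum.swap {A = A} {B = B})
  swap-injective {x = inj₁ _} {inj₁ _} refl = refl
  swap-injective {x = inj₂ _} {inj₂ _} refl = refl

  right-restriction : ∀ {A B : Set} (D : List (Fault (A ⊎ B))) → deletion D ∘ᵈ inj₂ ≼ deletion (rightFaults D)
  right-restriction D = ≼-trans (∘ᵈ-mono inj₂ (deletion-map Sum.swap swap-injective D)) (left-restriction (map swapFault D))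

  module _ {A B : Set} where

    length-sides : ∀ (D : List (Fault (A ⊎ B))) → length (leftFaults D) + length (rightFaults D) + length (crossFaults D) ≡ length D
    length-sides [] = refl
    length-sides (inj₁ (inj₁ a) ∷ D) = cong suc (length-sides D)
    length-sides (inj₁ (inj₂ b) ∷ D) = trans (cong (_+ length (crossFaults D)) (ℕ.+-suc (length (leftFaults D)) _)) (cong suc (length-sides D))
    length-sides (inj₂ (inj₁ a , inj₁ a′) ∷ D) = cong suc (length-sides D)
    length-sides (inj₂ (inj₂ b , inj₂ b′) ∷ D) = trans (cong (_+ length (crossFaults D)) (ℕ.+-suc (length (leftFaults D)) _)) (cong suc (length-sides D))
    length-sides (inj₂ (inj₁ a , inj₂ b) ∷ D) = trans (ℕ.+-suc _ _) (cong suc (length-sides D))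
    length-sides (inj₂ (inj₂ b , inj₁ a) ∷ D) = trans (ℕ.+-suc _ _) (cong suc (length-sides D))

    countVertices-sides : ∀ (D : List (Fault (A ⊎ B))) → countVertices (leftFaults D) + countVertices (rightFaults D) ≡ countVertices D
    countVertices-sides [] = refl
    countVertices-sides (inj₁ (inj₁ a) ∷ D) = cong suc (countVertices-sides D)
    countVertices-sides (inj₁ (inj₂ b) ∷ D) = trans (ℕ.+-suc _ _) (cong suc (countVertices-sides D))
    countVertices-sides (inj₂ (inj₁ a , inj₁ a′) ∷ D) = countVertices-sides D
    countVertices-sides (inj₂ (inj₂ b , inj₂ b′) ∷ D) = countVertices-sides D
    countVertices-sides (inj₂ (inj₁ a , inj₂ b) ∷ D) = countVertices-sides D
    countVertices-sides (inj₂ (inj₂ b , inj₁ a) ∷ D) = countVertices-sides D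

    swapFault-involutive : ∀ (D : List (Fault (A ⊎ B))) → map swapFault (map swapFault D) ≡ D
    swapFault-involutive [] = refl
    swapFault-involutive (inj₁ x ∷ D) = cong₂ _∷_ (cong inj₁ (swap-involutive x)) (swapFault-involutive D)
    swapFault-involutive (inj₂ (x , y) ∷ D) =
      cong₂ _∷_ (cong₂ (λ s t → inj₂ (s , t)) (swap-involutive x) (swap-involutive y)) (swapFault-involutive D)

    rightFaults-swap : ∀ (D : List (Fault (A ⊎ B))) → rightFaults (map swapFault D) ≡ leftFaults D
    rightFaults-swap D = cong leftFaults (swapFault-involutive D)

  countVertices-map : ∀ {V V′ : Set} (σ : V → V′) (D : List (Fault V)) → countVertices (map (mapFault σ) D) ≡ countVertices D
  countVertices-map σ [] = refl
  countVertices-map σ (inj₁ _ ∷ D) = cong suc (countVertices-map σ D)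
  countVertices-map σ (inj₂ _ ∷ D) = countVertices-map σ D

module Join {k : ℕ} (G₀ G₁ : Fin k → Fin k → Bool) (φ ψ : Fin k → Fin k)
            (ψ∘φ : ∀ i → ψ (φ i) ≡ i) (φ∘ψ : ∀ j → φ (ψ j) ≡ j) where

  open import Data.Fin.Properties using (_≟_)
  open import Data.Bool using (T)
  open import Data.Sum using (_⊎_; inj₁; inj₂)
  open import Data.Product using (_×_; _,_; proj₁; proj₂)
  open import Data.Rational using (ℚ; 0ℚ; 1ℚ; _+_; _*_; _-_; -_; _≤_)
  open import Data.Rational.Properties using (≤-refl; +-identityˡ; +-identityʳ; *-zeroʳ; *-identityʳ; +-mono-≤; +-monoˡ-≤; +-inverseʳ)
  open import Data.Rational.Solver using (module +-*-Solver)
  open import Relation.Nullary using (¬_; yes; no; ⌊_⌋)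
  open import Data.Empty using (⊥-elim)
  open import Function using (_∘_; Equivalence)
  open Rational
  open Matching

  Vertex : Set
  Vertex = Fin k ⊎ Fin k

  joined : Vertex → Vertex → Bool
  joined (inj₁ i) (inj₁ j) = G₀ i j
  joined (inj₂ i) (inj₂ j) = G₁ i j
  joined (inj₁ i) (inj₂ j) = ⌊ φ i ≟ j ⌋
  joined (inj₂ j) (inj₁ i) = ⌊ φ i ≟ j ⌋

  ∑ʲ : (Vertex → ℚ) → ℚ
  ∑ʲ f = sum (f ∘ inj₁) + sum (f ∘ inj₂)

  φ≡⇒≡ψ : ∀ {i j} → φ i ≡ j → i ≡ ψ j
  φ≡⇒≡ψ {i} φi≡j = trans (sym (ψ∘φ i)) (cong ψ φi≡j)

  ≡ψ⇒φ≡ : ∀ {i j} → i ≡ ψ j → φ i ≡ j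
  ≡ψ⇒φ≡ {j = j} i≡ψj = trans (cong φ i≡ψj) (φ∘ψ j)

  sum-over-partners : ∀ (e : Fin k → ℚ) j → sum (λ i → if j ≐ φ i then e i else 0ℚ) ≡ e (ψ j)
  sum-over-partners e j = trans (sum-cong-≗ partner) (sum-single (ψ j) e)
    where
    partner : ∀ i → (if j ≐ φ i then e i else 0ℚ) ≡ (if i ≐ ψ j then e i else 0ℚ)
    partner i with j ≟ φ i | i ≟ ψ j
    ... | yes _ | yes _ = refl
    ... | no _ | no _ = refl
    ... | yes j≡φi | no i≢ψj = ⊥-elim (i≢ψj (φ≡⇒≡ψ (sym j≡φi)))
    ... | no j≢φi | yes i≡ψj = ⊥-elim (j≢φi (sym (≡ψ⇒φ≡ i≡ψj)))

  CrossIntact : Deletion Vertex → Fin k → Set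
  CrossIntact Δ i = ¬ edge Δ (inj₁ i) (inj₂ (φ i)) × ¬ vertex Δ (inj₂ (φ i))

  -- L and R are the weights inside the two halves, X i j the weight of the edge from inj₁ i to inj₂ j
  record Blocks (Δ : Deletion Vertex) : Set where
    field
      L X R : Fin k → Fin k → ℚ
      L-sym : ∀ i j → L i j ≡ L j i
      R-sym : ∀ i j → R i j ≡ R j i
      L-supp : ∀ i j → L i j ≢ 0ℚ → Available G₀ (Δ ∘ᵈ inj₁) i j
      R-supp : ∀ i j → R i j ≢ 0ℚ → Available G₁ (Δ ∘ᵈ inj₂) i j
      X-supp : ∀ i j → X i j ≢ 0ℚ → φ i ≡ j × ¬ vertex Δ (inj₁ i) × CrossIntact Δ i
      L-nonneg : ∀ i j → 0ℚ ≤ L i j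
      X-nonneg : ∀ i j → 0ℚ ≤ X i j
      R-nonneg : ∀ i j → 0ℚ ≤ R i j
      left-saturated : ∀ i → ¬ vertex Δ (inj₁ i) → sum (L i) + sum (X i) ≡ 1ℚ
      right-saturated : ∀ j → ¬ vertex Δ (inj₂ j) → sum (λ i → X i j) + sum (R j) ≡ 1ℚ

  assemble : ∀ {Δ} → Blocks Δ → FPM ∑ʲ joined Δ
  assemble {Δ} B = record
    { weight = g ; weight-sym = g-sym ; weight-supp = g-supp ; weight-nonneg = g-nonneg ; saturated = g-saturated }
    where
    open Blocks B
    g : Vertex → Vertex → ℚ
    g (inj₁ i) (inj₁ j) = L i j
    g (inj₁ i) (inj₂ j) = X i j
    g (inj₂ j) (inj₁ i) = X i j
    g (inj₂ i) (inj₂ j) = R i j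
    g-sym : ∀ a b → g a b ≡ g b a
    g-sym (inj₁ i) (inj₁ j) = L-sym i j
    g-sym (inj₁ i) (inj₂ j) = refl
    g-sym (inj₂ j) (inj₁ i) = refl
    g-sym (inj₂ i) (inj₂ j) = R-sym i j
    cross-edge : ∀ {i j} → φ i ≡ j → T ⌊ φ i ≟ j ⌋
    cross-edge {i} {j} φi≡j with φ i ≟ j
    ... | yes _ = _
    ... | no φi≢j = φi≢j φi≡j
    g-supp : ∀ a b → g a b ≢ 0ℚ → Available joined Δ a b
    g-supp (inj₁ i) (inj₁ j) = L-supp i j
    g-supp (inj₂ i) (inj₂ j) = R-supp i j
    g-supp (inj₁ i) (inj₂ j) X≢0 with X-supp i j X≢0
    ... | refl , i∉Δ , ij∉Δ , j∉Δ = cross-edge refl , i∉Δ , j∉Δ , ij∉Δ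
    g-supp (inj₂ j) (inj₁ i) X≢0 with X-supp i j X≢0
    ... | refl , i∉Δ , ij∉Δ , j∉Δ = cross-edge refl , j∉Δ , i∉Δ , ij∉Δ ∘ edge-sym Δ
    g-nonneg : ∀ a b → 0ℚ ≤ g a b
    g-nonneg (inj₁ i) (inj₁ j) = L-nonneg i j
    g-nonneg (inj₁ i) (inj₂ j) = X-nonneg i j
    g-nonneg (inj₂ j) (inj₁ i) = X-nonneg i j
    g-nonneg (inj₂ i) (inj₂ j) = R-nonneg i j
    g-saturated : ∀ a → ¬ vertex Δ a → ∑ʲ (g a) ≡ 1ℚ
    g-saturated (inj₁ i) = left-saturated i
    g-saturated (inj₂ j) = right-saturated j

  glue : ∀ {Δ} → FPM sum G₀ (Δ ∘ᵈ inj₁) → FPM sum G₁ (Δ ∘ᵈ inj₂) → FPM ∑ʲ joined Δ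
  glue {Δ} M₀ M₁ = assemble record
    { L = weight M₀ ; X = λ _ _ → 0ℚ ; R = weight M₁
    ; L-sym = weight-sym M₀ ; R-sym = weight-sym M₁
    ; L-supp = weight-supp M₀ ; R-supp = weight-supp M₁ ; X-supp = λ i j 0≢0 → ⊥-elim (0≢0 refl)
    ; L-nonneg = weight-nonneg M₀ ; X-nonneg = λ _ _ → ≤-refl ; R-nonneg = weight-nonneg M₁
    ; left-saturated = λ i i∉Δ → trans (cong₂ _+_ (saturated M₀ i i∉Δ) (sum-zero k)) (+-identityʳ 1ℚ)
    ; right-saturated = λ j j∉Δ → trans (cong₂ _+_ (sum-zero k) (saturated M₁ j j∉Δ)) (+-identityˡ 1ℚ)
    }

  open +-*-Solver

  -- Deleting x from G₀ and routing its weight g₀ x w through the cross edge at w onto the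
  -- matching h w of G₁ − φ w.  The right half is the convex combination ∑ w, g₀ x w · h w.
  vertex-defect : (∀ i → G₀ i i ≡ false) → ∀ {Δ Δ₀} (M₀ : FPM sum G₀ Δ₀) x → ¬ vertex Δ₀ x
    → Δ ∘ᵈ inj₁ ≼ Δ₀ +ᵛ x
    → (∀ w → FPM sum G₁ ((Δ ∘ᵈ inj₂) +ᵛ φ w))
    → (∀ w → weight M₀ x w ≢ 0ℚ → CrossIntact Δ w)
    → FPM ∑ʲ joined Δ
  vertex-defect irreflexive {Δ} {Δ₀} M₀ x x∉Δ₀ left h intact = assemble record
    { L = L ; X = X ; R = R ; L-sym = L-sym ; R-sym = R-sym
    ; L-supp = L-supp ; R-supp = R-supp ; X-supp = X-supp
    ; L-nonneg = λ i j → if-nonneg {i = i} {x} ≤-refl (if-nonneg {i = j} {x} ≤-refl (weight-nonneg M₀ i j))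
    ; X-nonneg = λ i j → if-nonneg {i = j} {φ i} (weight-nonneg M₀ x i) ≤-refl
    ; R-nonneg = λ z y → sum-nonneg _ (λ w → *-nonneg (weight-nonneg M₀ x w) (weight-nonneg (h w) z y))
    ; left-saturated = left-saturated ; right-saturated = right-saturated
    }
    where
    g₀ : Fin k → Fin k → ℚ
    g₀ = weight M₀
    c : Fin k → ℚ
    c w = g₀ x w
    L X R : Fin k → Fin k → ℚ
    L i j = if i ≐ x then 0ℚ else (if j ≐ x then 0ℚ else g₀ i j)
    X i j = if j ≐ φ i then c i else 0ℚ
    R z y = sum (λ w → c w * weight (h w) z y)

    deleted-left : ∀ {i} → vertex Δ (inj₁ i) → i ≡ x ⊎ vertex Δ₀ i
    deleted-left = Equivalence.to (_≼_.same-vertices left _)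
    kept-left : ∀ {i} → i ≢ x → ¬ vertex Δ₀ i → ¬ vertex Δ (inj₁ i)
    kept-left i≢x i∉Δ₀ i∈Δ with deleted-left i∈Δ
    ... | inj₁ i≡x = i≢x i≡x
    ... | inj₂ i∈Δ₀ = i∉Δ₀ i∈Δ₀

    L-row : ∀ {i} → i ≢ x → ∀ j → L i j ≡ (if j ≐ x then 0ℚ else g₀ i j)
    L-row {i} i≢x j with i ≟ x
    ... | yes i≡x = ⊥-elim (i≢x i≡x)
    ... | no _ = refl

    L-sym : ∀ i j → L i j ≡ L j i
    L-sym i j with i ≟ x | j ≟ x
    ... | yes _ | yes _ = refl
    ... | yes _ | no _ = refl
    ... | no _ | yes _ = refl
    ... | no _ | no _ = weight-sym M₀ i j

    R-sym : ∀ i j → R i j ≡ R j i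
    R-sym i j = sum-cong-≗ (λ w → cong (c w *_) (weight-sym (h w) i j))

    L-supp : ∀ i j → L i j ≢ 0ℚ → Available G₀ (Δ ∘ᵈ inj₁) i j
    L-supp i j L≢0 with i ≟ x | j ≟ x
    ... | yes _ | _ = ⊥-elim (L≢0 refl)
    ... | no _ | yes _ = ⊥-elim (L≢0 refl)
    ... | no i≢x | no j≢x with weight-supp M₀ i j L≢0
    ... | ij∈G₀ , i∉Δ₀ , j∉Δ₀ , ij∉Δ₀ = ij∈G₀ , kept-left i≢x i∉Δ₀ , kept-left j≢x j∉Δ₀ , ij∉Δ₀ ∘ _≼_.fewer-edges left

    R-supp : ∀ z y → R z y ≢ 0ℚ → Available G₁ (Δ ∘ᵈ inj₂) z y
    R-supp z y R≢0 with sum≢0⇒term≢0 _ R≢0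
    ... | w , term≢0 with weight-supp (h w) z y (*≢0⇒≢0 (c w) term≢0)
    ... | zy∈G₁ , z∉Δ , y∉Δ , zy∉Δ = zy∈G₁ , z∉Δ ∘ inj₂ , y∉Δ ∘ inj₂ , zy∉Δ

    X-supp : ∀ i j → X i j ≢ 0ℚ → φ i ≡ j × ¬ vertex Δ (inj₁ i) × CrossIntact Δ i
    X-supp i j X≢0 with if≢0 {i = j} {φ i} X≢0
    ... | refl , cᵢ≢0 = refl , i∉Δ , intact i cᵢ≢0
      where
      i∉Δ : ¬ vertex Δ (inj₁ i)
      i∉Δ i∈Δ with deleted-left i∈Δ
      ... | inj₁ refl = subst T (irreflexive x) (proj₁ (weight-supp M₀ x x cᵢ≢0))
      ... | inj₂ i∈Δ₀ = proj₁ (proj₂ (proj₂ (weight-supp M₀ x i cᵢ≢0))) i∈Δ₀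

    left-saturated : ∀ i → ¬ vertex Δ (inj₁ i) → sum (L i) + sum (X i) ≡ 1ℚ
    left-saturated i i∉Δ = begin
      sum (L i) + sum (X i)                              ≡⟨ cong₂ _+_ (sum-cong-≗ (L-row i≢x)) (sum-single (φ i) (λ _ → c i)) ⟩
      sum (λ j → if j ≐ x then 0ℚ else g₀ i j) + c i   ≡⟨ cong (_+ c i) (sum-except x (g₀ i)) ⟩
      (sum (g₀ i) - g₀ i x) + g₀ x i                    ≡⟨ cong₂ (λ s t → (s - g₀ i x) + t) (saturated M₀ i i∉Δ₀) (weight-sym M₀ x i) ⟩
      (1ℚ - g₀ i x) + g₀ i x                             ≡⟨ solve 1 (λ a → (con 1ℚ :- a) :+ a := con 1ℚ) refl (g₀ i x) ⟩
      1ℚ                                                 ∎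
      where
      open ≡-Reasoning
      i≢x : i ≢ x
      i≢x i≡x = i∉Δ (Equivalence.from (_≼_.same-vertices left i) (inj₁ i≡x))
      i∉Δ₀ : ¬ vertex Δ₀ i
      i∉Δ₀ i∈Δ₀ = i∉Δ (Equivalence.from (_≼_.same-vertices left i) (inj₂ i∈Δ₀))

    right-saturated : ∀ z → ¬ vertex Δ (inj₂ z) → sum (λ i → X i z) + sum (R z) ≡ 1ℚ
    right-saturated z z∉Δ = begin
      sum (λ i → X i z) + sum (R z)
        ≡⟨ cong₂ _+_ (sum-over-partners c z) (∑-comm (λ y w → c w * weight (h w) z y)) ⟩
      c (ψ z) + sum (λ w → sum (λ y → c w * weight (h w) z y))
        ≡⟨ cong (c (ψ z) +_) (sum-cong-≗ (λ w → sym (*-distribˡ-sum (c w) (weight (h w) z)))) ⟩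
      c (ψ z) + sum (λ w → c w * sum (weight (h w) z))
        ≡⟨ cong (c (ψ z) +_) (sum-cong-≗ row-sum) ⟩
      c (ψ z) + sum (λ w → if w ≐ ψ z then 0ℚ else c w)
        ≡⟨ cong (c (ψ z) +_) (sum-except (ψ z) c) ⟩
      c (ψ z) + (sum c - c (ψ z))
        ≡⟨ cong (λ s → c (ψ z) + (s - c (ψ z))) (saturated M₀ x x∉Δ₀) ⟩
      c (ψ z) + (1ℚ - c (ψ z))
        ≡⟨ solve 1 (λ a → a :+ (con 1ℚ :- a) := con 1ℚ) refl (c (ψ z)) ⟩
      1ℚ ∎
      where
      open ≡-Reasoning
      row-sum : ∀ w → c w * sum (weight (h w) z) ≡ (if w ≐ ψ z then 0ℚ else c w)
      row-sum w with w ≟ ψ z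
      ... | yes w≡ψz = trans (cong (c w *_) (sum-at-deleted (h w) (inj₁ (sym (≡ψ⇒φ≡ w≡ψz))))) (*-zeroʳ (c w))
      ... | no w≢ψz = trans (cong (c w *_) (saturated (h w) z z∉Δw)) (*-identityʳ (c w))
        where
        z∉Δw : ¬ (z ≡ φ w ⊎ vertex Δ (inj₂ z))
        z∉Δw (inj₁ z≡φw) = w≢ψz (φ≡⇒≡ψ (sym z≡φw))
        z∉Δw (inj₂ z∈Δ) = z∉Δ z∈Δ

  -- Deleting the edge uv from G₀ and routing its weight c = g₀ u v through the cross edges at u and v;
  -- the right half is c · h + (1 − c) · h′ with h a matching of G₁ − {φ u, φ v}.
  edge-defect : ∀ {Δ Δ₀} (M₀ : FPM sum G₀ Δ₀) u v → u ≢ v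
    → Δ ∘ᵈ inj₁ ≼ Δ₀ +ᵉ (u , v)
    → FPM sum G₁ (Δ ∘ᵈ inj₂ +ᵛ φ u +ᵛ φ v)
    → FPM sum G₁ (Δ ∘ᵈ inj₂)
    → (weight M₀ u v ≢ 0ℚ → CrossIntact Δ u × CrossIntact Δ v)
    → FPM ∑ʲ joined Δ
  edge-defect {Δ} {Δ₀} M₀ u v u≢v left h h′ intact = assemble record
    { L = L ; X = X ; R = R ; L-sym = L-sym ; R-sym = R-sym
    ; L-supp = L-supp ; R-supp = R-supp ; X-supp = X-supp
    ; L-nonneg = L-nonneg ; X-nonneg = X-nonneg ; R-nonneg = R-nonneg
    ; left-saturated = left-saturated ; right-saturated = right-saturated
    }
    where
    g₀ : Fin k → Fin k → ℚ
    g₀ = weight M₀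
    c : ℚ
    c = g₀ u v
    OnPair : Fin k → Fin k → Set
    OnPair i j = (i ≡ u × j ≡ v) ⊎ (i ≡ v × j ≡ u)
    L X R : Fin k → Fin k → ℚ
    L i j = if i ≐ u then (if j ≐ v then 0ℚ else g₀ i j) else (if i ≐ v then (if j ≐ u then 0ℚ else g₀ i j) else g₀ i j)
    e : Fin k → ℚ
    e i = if i ≐ u then c else (if i ≐ v then c else 0ℚ)
    X i j = if j ≐ φ i then e i else 0ℚ
    R z y = c * weight h z y + (1ℚ - c) * weight h′ z y

    L-cases : ∀ i j → (L i j ≡ g₀ i j × ¬ OnPair i j) ⊎ (L i j ≡ 0ℚ × OnPair i j)
    L-cases i j with i ≟ u | i ≟ v | j ≟ u | j ≟ v
    ... | yes i≡u | yes i≡v | _ | _ = ⊥-elim (u≢v (trans (sym i≡u) i≡v))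
    ... | _ | _ | yes j≡u | yes j≡v = ⊥-elim (u≢v (trans (sym j≡u) j≡v))
    ... | yes i≡u | no _ | _ | yes j≡v = inj₂ (refl , inj₁ (i≡u , j≡v))
    ... | yes _ | no i≢v | _ | no j≢v = inj₁ (refl , λ { (inj₁ (_ , j≡v)) → j≢v j≡v ; (inj₂ (i≡v , _)) → i≢v i≡v })
    ... | no _ | yes i≡v | yes j≡u | _ = inj₂ (refl , inj₂ (i≡v , j≡u))
    ... | no i≢u | yes _ | no j≢u | _ = inj₁ (refl , λ { (inj₁ (i≡u , _)) → i≢u i≡u ; (inj₂ (_ , j≡u)) → j≢u j≡u })
    ... | no i≢u | no i≢v | _ | _ = inj₁ (refl , λ { (inj₁ (i≡u , _)) → i≢u i≡u ; (inj₂ (i≡v , _)) → i≢v i≡v })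

    OnPair-sym : ∀ {i j} → OnPair i j → OnPair j i
    OnPair-sym (inj₁ (i≡u , j≡v)) = inj₂ (j≡v , i≡u)
    OnPair-sym (inj₂ (i≡v , j≡u)) = inj₁ (j≡u , i≡v)

    L-sym : ∀ i j → L i j ≡ L j i
    L-sym i j with L-cases i j | L-cases j i
    ... | inj₁ (Lij≡g , _) | inj₁ (Lji≡g , _) = trans Lij≡g (trans (weight-sym M₀ i j) (sym Lji≡g))
    ... | inj₂ (Lij≡0 , _) | inj₂ (Lji≡0 , _) = trans Lij≡0 (sym Lji≡0)
    ... | inj₁ (_ , ¬ij) | inj₂ (_ , ji) = ⊥-elim (¬ij (OnPair-sym ji))
    ... | inj₂ (_ , ij) | inj₁ (_ , ¬ji) = ⊥-elim (¬ji (OnPair-sym ij))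

    R-sym : ∀ i j → R i j ≡ R j i
    R-sym i j = cong₂ (λ s t → c * s + (1ℚ - c) * t) (weight-sym h i j) (weight-sym h′ i j)
    left-deleted : ∀ {i} → vertex Δ (inj₁ i) → vertex Δ₀ i
    left-deleted = Equivalence.to (_≼_.same-vertices left _)
    left-kept : ∀ {i} → ¬ vertex Δ₀ i → ¬ vertex Δ (inj₁ i)
    left-kept i∉Δ₀ = i∉Δ₀ ∘ left-deleted

    L-supp : ∀ i j → L i j ≢ 0ℚ → Available G₀ (Δ ∘ᵈ inj₁) i j
    L-supp i j L≢0 with L-cases i j
    ... | inj₂ (L≡0 , _) = ⊥-elim (L≢0 L≡0)
    ... | inj₁ (L≡g , ¬ij) with weight-supp M₀ i j (L≢0 ∘ trans L≡g)
    ... | ij∈G₀ , i∉Δ₀ , j∉Δ₀ , ij∉Δ₀ = ij∈G₀ , left-kept i∉Δ₀ , left-kept j∉Δ₀ , ij∉Δ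
      where
      ij∉Δ : ¬ edge Δ (inj₁ i) (inj₁ j)
      ij∉Δ ij∈Δ with _≼_.fewer-edges left ij∈Δ
      ... | inj₁ ij∈Δ₀ = ij∉Δ₀ ij∈Δ₀
      ... | inj₂ ij = ¬ij ij

    R-supp : ∀ z y → R z y ≢ 0ℚ → Available G₁ (Δ ∘ᵈ inj₂) z y
    R-supp z y R≢0 with +≢0 (c * weight h z y) _ R≢0
    ... | inj₁ ch≢0 with weight-supp h z y (*≢0⇒≢0 c ch≢0)
    ... | zy∈G₁ , z∉Δ , y∉Δ , zy∉Δ = zy∈G₁ , z∉Δ ∘ inj₂ ∘ inj₂ , y∉Δ ∘ inj₂ ∘ inj₂ , zy∉Δ
    R-supp z y R≢0 | inj₂ ch′≢0 = weight-supp h′ z y (*≢0⇒≢0 (1ℚ - c) ch′≢0)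

    EndpointCase : Fin k → Set
    EndpointCase i = (i ≡ u × e i ≡ c) ⊎ (i ≡ v × e i ≡ c) ⊎ (i ≢ u × i ≢ v × e i ≡ 0ℚ)

    e-cases : ∀ i → EndpointCase i
    e-cases i with i ≟ u | i ≟ v
    ... | yes i≡u | _ = inj₁ (i≡u , refl)
    ... | no _ | yes i≡v = inj₂ (inj₁ (i≡v , refl))
    ... | no i≢u | no i≢v = inj₂ (inj₂ (i≢u , i≢v , refl))

    X-supp : ∀ i j → X i j ≢ 0ℚ → φ i ≡ j × ¬ vertex Δ (inj₁ i) × CrossIntact Δ i
    X-supp i j X≢0 with if≢0 {i = j} {φ i} X≢0
    ... | refl , eᵢ≢0 with e-cases i
    ... | inj₁ (refl , e≡c) = refl , left-kept (proj₁ (proj₂ (weight-supp M₀ u v c≢0))) , proj₁ (intact c≢0)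
      where
      c≢0 : c ≢ 0ℚ
      c≢0 = eᵢ≢0 ∘ trans e≡c
    ... | inj₂ (inj₁ (refl , e≡c)) = refl , left-kept (proj₁ (proj₂ (proj₂ (weight-supp M₀ u v c≢0)))) , proj₂ (intact c≢0)
      where
      c≢0 : c ≢ 0ℚ
      c≢0 = eᵢ≢0 ∘ trans e≡c
    ... | inj₂ (inj₂ (_ , _ , e≡0)) = ⊥-elim (eᵢ≢0 e≡0)

    L-nonneg : ∀ i j → 0ℚ ≤ L i j
    L-nonneg i j with L-cases i j
    ... | inj₁ (L≡g , _) = subst (0ℚ ≤_) (sym L≡g) (weight-nonneg M₀ i j)
    ... | inj₂ (L≡0 , _) = subst (0ℚ ≤_) (sym L≡0) ≤-refl

    X-nonneg : ∀ i j → 0ℚ ≤ X i j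
    X-nonneg i j = if-nonneg {i = j} {φ i} e-nonneg ≤-refl
      where
      e-nonneg : 0ℚ ≤ e i
      e-nonneg with e-cases i
      ... | inj₁ (_ , e≡c) = subst (0ℚ ≤_) (sym e≡c) (weight-nonneg M₀ u v)
      ... | inj₂ (inj₁ (_ , e≡c)) = subst (0ℚ ≤_) (sym e≡c) (weight-nonneg M₀ u v)
      ... | inj₂ (inj₂ (_ , _ , e≡0)) = subst (0ℚ ≤_) (sym e≡0) ≤-refl

    R-nonneg : ∀ i j → 0ℚ ≤ R i j
    R-nonneg z y = subst (_≤ R z y) (+-identityˡ 0ℚ)
      (+-mono-≤ (*-nonneg (weight-nonneg M₀ u v) (weight-nonneg h z y)) (*-nonneg 0≤1-c (weight-nonneg h′ z y)))
      where
      0≤1-c : 0ℚ ≤ 1ℚ - c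
      0≤1-c = subst (_≤ 1ℚ - c) (+-inverseʳ c) (+-monoˡ-≤ (- c) (weight≤1 M₀ u v))

    L-row-u : ∀ y → L u y ≡ (if y ≐ v then 0ℚ else g₀ u y)
    L-row-u y with u ≟ u
    ... | yes _ = refl
    ... | no u≢u = ⊥-elim (u≢u refl)

    L-row-v : ∀ y → L v y ≡ (if y ≐ u then 0ℚ else g₀ v y)
    L-row-v y with v ≟ u | v ≟ v
    ... | yes v≡u | _ = ⊥-elim (u≢v (sym v≡u))
    ... | no _ | yes _ = refl
    ... | no _ | no v≢v = ⊥-elim (v≢v refl)

    L-row-other : ∀ {i} → i ≢ u → i ≢ v → ∀ y → L i y ≡ g₀ i y
    L-row-other {i} i≢u i≢v y with i ≟ u | i ≟ v
    ... | yes i≡u | _ = ⊥-elim (i≢u i≡u)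
    ... | no _ | yes i≡v = ⊥-elim (i≢v i≡v)
    ... | no _ | no _ = refl

    open ≡-Reasoning

    defect-row : ∀ {i j} → ¬ vertex Δ₀ i → (∀ y → L i y ≡ (if y ≐ j then 0ℚ else g₀ i y)) → e i ≡ g₀ i j
               → sum (L i) + sum (X i) ≡ 1ℚ
    defect-row {i} {j} i∉Δ₀ row e≡g = begin
      sum (L i) + sum (X i)                              ≡⟨ cong₂ _+_ (sum-cong-≗ row) (sum-single (φ i) (λ _ → e i)) ⟩
      sum (λ y → if y ≐ j then 0ℚ else g₀ i y) + e i   ≡⟨ cong₂ _+_ (sum-except j (g₀ i)) e≡g ⟩
      (sum (g₀ i) - g₀ i j) + g₀ i j                    ≡⟨ cong (λ s → (s - g₀ i j) + g₀ i j) (saturated M₀ i i∉Δ₀) ⟩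
      (1ℚ - g₀ i j) + g₀ i j                             ≡⟨ solve 1 (λ a → (con 1ℚ :- a) :+ a := con 1ℚ) refl (g₀ i j) ⟩
      1ℚ                                                 ∎

    left-saturated : ∀ i → ¬ vertex Δ (inj₁ i) → sum (L i) + sum (X i) ≡ 1ℚ
    left-saturated i i∉Δ with e-cases i
    ... | inj₁ (refl , e≡c) = defect-row i∉Δ₀ L-row-u e≡c
      where i∉Δ₀ = i∉Δ ∘ Equivalence.from (_≼_.same-vertices left i)
    ... | inj₂ (inj₁ (refl , e≡c)) = defect-row i∉Δ₀ L-row-v (trans e≡c (weight-sym M₀ u v))
      where i∉Δ₀ = i∉Δ ∘ Equivalence.from (_≼_.same-vertices left i)
    ... | inj₂ (inj₂ (i≢u , i≢v , e≡0)) = begin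
      sum (L i) + sum (X i)   ≡⟨ cong₂ _+_ (sum-cong-≗ (L-row-other i≢u i≢v)) (sum-single (φ i) (λ _ → e i)) ⟩
      sum (g₀ i) + e i        ≡⟨ cong₂ _+_ (saturated M₀ i (i∉Δ ∘ Equivalence.from (_≼_.same-vertices left i))) e≡0 ⟩
      1ℚ + 0ℚ                 ≡⟨ +-identityʳ 1ℚ ⟩
      1ℚ                      ∎

    right-saturated : ∀ z → ¬ vertex Δ (inj₂ z) → sum (λ i → X i z) + sum (R z) ≡ 1ℚ
    right-saturated z z∉Δ = begin
      sum (λ i → X i z) + sum (R z)
        ≡⟨ cong₂ _+_ (sum-over-partners e z) (∑-distrib-+ (λ y → c * weight h z y) _) ⟩
      e (ψ z) + (sum (λ y → c * weight h z y) + sum (λ y → (1ℚ - c) * weight h′ z y))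
        ≡⟨ cong (e (ψ z) +_) (cong₂ _+_ (sym (*-distribˡ-sum c (weight h z))) (sym (*-distribˡ-sum (1ℚ - c) (weight h′ z)))) ⟩
      e (ψ z) + (c * sum (weight h z) + (1ℚ - c) * sum (weight h′ z))
        ≡⟨ cong (λ s → e (ψ z) + (c * sum (weight h z) + (1ℚ - c) * s)) (saturated h′ z z∉Δ) ⟩
      e (ψ z) + (c * sum (weight h z) + (1ℚ - c) * 1ℚ)
        ≡⟨ by-partner (e-cases (ψ z)) ⟩
      1ℚ ∎
      where
      by-partner : EndpointCase (ψ z) → e (ψ z) + (c * sum (weight h z) + (1ℚ - c) * 1ℚ) ≡ 1ℚ
      by-partner (inj₁ (ψz≡u , e≡c)) =
        trans (cong₂ (λ s t → s + (c * t + (1ℚ - c) * 1ℚ)) e≡c (sum-at-deleted h (inj₂ (inj₁ (sym (≡ψ⇒φ≡ (sym ψz≡u)))))))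
              (solve 1 (λ a → a :+ (a :* con 0ℚ :+ (con 1ℚ :- a) :* con 1ℚ) := con 1ℚ) refl c)
      by-partner (inj₂ (inj₁ (ψz≡v , e≡c))) =
        trans (cong₂ (λ s t → s + (c * t + (1ℚ - c) * 1ℚ)) e≡c (sum-at-deleted h (inj₁ (sym (≡ψ⇒φ≡ (sym ψz≡v))))))
              (solve 1 (λ a → a :+ (a :* con 0ℚ :+ (con 1ℚ :- a) :* con 1ℚ) := con 1ℚ) refl c)
      by-partner (inj₂ (inj₂ (ψz≢u , ψz≢v , e≡0))) =
        trans (cong₂ (λ s t → s + (c * t + (1ℚ - c) * 1ℚ)) e≡0 (saturated h z z∉Δ′))
              (solve 1 (λ a → con 0ℚ :+ (a :* con 1ℚ :+ (con 1ℚ :- a) :* con 1ℚ) := con 1ℚ) refl c)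
        where
        z∉Δ′ : ¬ (z ≡ φ v ⊎ z ≡ φ u ⊎ vertex Δ (inj₂ z))
        z∉Δ′ (inj₁ z≡φv) = ψz≢v (sym (φ≡⇒≡ψ (sym z≡φv)))
        z∉Δ′ (inj₂ (inj₁ z≡φu)) = ψz≢u (sym (φ≡⇒≡ψ (sym z≡φu)))
        z∉Δ′ (inj₂ (inj₂ z∈Δ)) = z∉Δ z∈Δ

module BaseCase where

  open import Data.Nat using (zero; suc; _+_; _∸_; s≤s)
  open import Data.Nat.DivMod using (_mod_)
  open import Data.Fin using (Fin; zero; suc; #_; toℕ)
  open import Data.Fin.Properties using (_≟_; all?; any?)
  open import Data.Bool using (Bool; _∧_; _∨_; if_then_else_)
  open import Data.Bool.Properties using (T?)
  open import Data.Sum using (_⊎_; inj₁; inj₂; [_,_]′)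
  import Data.Sum.Properties as Sum
  open import Data.Product using (_×_; _,_; proj₁; proj₂)
  import Data.Product as Product
  import Data.Product.Properties as Product
  open import Data.List using (List; []; _∷_; map)
  open import Data.List.Relation.Unary.Any using (here; there)
  open import Data.List.Membership.Propositional using (_∈_)
  open import Data.Rational using (ℚ; 0ℚ; 1ℚ; ½; _≤_)
  open import Data.Rational.Properties using (_≤?_) renaming (_≟_ to _≟ℚ_)
  open import Relation.Nullary using (Dec; yes; no; ⌊_⌋)
  open import Relation.Nullary.Decidable using (toWitness; _×-dec_; _⊎-dec_; ¬?)
  open import Relation.Binary.PropositionalEquality
  open import Data.Empty using (⊥-elim)
  open import Function using (_∘_; mk⇔)
  open import Defs using (G84)
  open Matching
  open Rational using (sum)
  open Faults

  open import Data.List.Membership.DecPropositional (Sum.≡-dec (_≟_ {8}) (Product.≡-dec (_≟_ {8}) (_≟_ {8}))) using (_∈?_)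

  fromEdges : List (Fin 8 × Fin 8 × ℚ) → Fin 8 → Fin 8 → ℚ
  fromEdges [] u v = 0ℚ
  fromEdges ((a , b , w) ∷ es) u v = if (⌊ a ≟ u ⌋ ∧ ⌊ b ≟ v ⌋) ∨ (⌊ a ≟ v ⌋ ∧ ⌊ b ≟ u ⌋) then w else fromEdges es u v

  Certifies : (Fin 8 → Fin 8 → ℚ) → List (Fault (Fin 8)) → Set
  Certifies g D = (∀ u v → g u v ≡ g v u × 0ℚ ≤ g u v × (g u v ≡ 0ℚ ⊎ Available G84 (deletion D) u v))
                × (∀ u → inj₁ u ∈ D ⊎ sum (g u) ≡ 1ℚ)

  certifies? : ∀ g D → Dec (Certifies g D)
  certifies? g D = all? (λ u → all? (λ v → (g u v ≟ℚ g v u) ×-dec (0ℚ ≤? g u v) ×-dec ((g u v ≟ℚ 0ℚ) ⊎-dec available? u v)))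
                   ×-dec all? (λ u → (inj₁ u ∈? D) ⊎-dec (sum (g u) ≟ℚ 1ℚ))
    where
    available? : ∀ u v → Dec (Available G84 (deletion D) u v)
    available? u v = T? (G84 u v) ×-dec ¬? (inj₁ u ∈? D) ×-dec ¬? (inj₁ v ∈? D) ×-dec ¬? ((inj₂ (u , v) ∈? D) ⊎-dec (inj₂ (v , u) ∈? D))

  certified : ∀ g D → Certifies g D → FPM sum G84 (deletion D)
  certified g D (local , rows) = record
    { weight = g
    ; weight-sym = λ u v → proj₁ (local u v)
    ; weight-supp = λ u v g≢0 → [ (λ g≡0 → ⊥-elim (g≢0 g≡0)) , (λ a → a) ]′ (proj₂ (proj₂ (local u v)))
    ; weight-nonneg = λ u v → proj₁ (proj₂ (local u v))
    ; saturated = λ u u∉D → [ (λ u∈D → ⊥-elim (u∉D u∈D)) , (λ s → s) ]′ (rows u)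
    }

  perfectMatching : Fin 3 → Fin 8 → Fin 8 → ℚ
  perfectMatching zero = fromEdges ((# 0 , # 1 , 1ℚ) ∷ (# 2 , # 3 , 1ℚ) ∷ (# 4 , # 5 , 1ℚ) ∷ (# 6 , # 7 , 1ℚ) ∷ [])
  perfectMatching (suc zero) = fromEdges ((# 1 , # 2 , 1ℚ) ∷ (# 3 , # 4 , 1ℚ) ∷ (# 5 , # 6 , 1ℚ) ∷ (# 7 , # 0 , 1ℚ) ∷ [])
  perfectMatching (suc (suc zero)) = fromEdges ((# 0 , # 4 , 1ℚ) ∷ (# 1 , # 5 , 1ℚ) ∷ (# 2 , # 6 , 1ℚ) ∷ (# 3 , # 7 , 1ℚ) ∷ [])

  perfectMatching-certified : ∀ i → Certifies (perfectMatching i) []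
  perfectMatching-certified = toWitness {a? = all? λ i → certifies? (perfectMatching i) []} _

  colour : Fin 8 → Fin 8 → Fin 3
  colour u v with any? (λ i → ¬? (perfectMatching i u v ≟ℚ 0ℚ))
  ... | yes (i , _) = i
  ... | no _ = zero

  -- the three perfect matchings are edge-disjoint
  uncoloured-unused : ∀ u v i → i ≡ colour u v ⊎ perfectMatching i u v ≡ 0ℚ
  uncoloured-unused = toWitness {a? = all? λ u → all? λ v → all? λ i → (i ≟ colour u v) ⊎-dec (perfectMatching i u v ≟ℚ 0ℚ)} _

  avoiding : Fin 3 → Fin 3 → Fin 3
  avoiding zero (suc zero) = # 2
  avoiding (suc zero) zero = # 2
  avoiding zero _ = # 1
  avoiding _ zero = # 1
  avoiding _ _ = # 0

  avoiding-differs : ∀ a b → a ≢ avoiding a b × b ≢ avoiding a b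
  avoiding-differs = toWitness {a? = all? λ a → all? λ b → ¬? (a ≟ avoiding a b) ×-dec ¬? (b ≟ avoiding a b)} _

  perfectMatching-survives : ∀ i (D : List (Fault (Fin 8))) → countVertices D ≡ 0
    → (∀ {u v} → inj₂ (u , v) ∈ D → colour u v ≢ i) → FPM sum G84 (deletion D)
  perfectMatching-survives i D none avoided =
    delete-unused-edges (certified _ [] (perfectMatching-certified i)) (λ x → mk⇔ (⊥-elim ∘ no-vertex-faults D none) λ ())
      λ { (inj₁ uv∈D) → inj₂ (unused uv∈D) ; (inj₂ vu∈D) → inj₂ (trans (proj₁ (proj₁ (perfectMatching-certified i) _ _)) (unused vu∈D)) }
    where
    unused : ∀ {u v} → inj₂ (u , v) ∈ D → perfectMatching i u v ≡ 0ℚ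
    unused {u} {v} uv∈D = [ (λ i≡colour → ⊥-elim (avoided uv∈D (sym i≡colour))) , (λ unused → unused) ]′ (uncoloured-unused u v i)
  rotate : Fin 8 → Fin 8 → Fin 8
  rotate a v = (toℕ v + toℕ a) mod 8

  withoutZeroAnd : Fin 8 → List (Fin 8 × Fin 8 × ℚ)
  withoutZeroAnd zero = (# 1 , # 2 , ½) ∷ (# 1 , # 5 , ½) ∷ (# 2 , # 6 , ½) ∷ (# 3 , # 4 , ½) ∷ (# 3 , # 7 , ½) ∷ (# 4 , # 5 , ½) ∷ (# 6 , # 7 , ½) ∷ []
  withoutZeroAnd (suc zero) = (# 2 , # 6 , 1ℚ) ∷ (# 3 , # 7 , 1ℚ) ∷ (# 4 , # 5 , 1ℚ) ∷ []
  withoutZeroAnd (suc (suc zero)) = (# 1 , # 5 , 1ℚ) ∷ (# 3 , # 4 , 1ℚ) ∷ (# 6 , # 7 , 1ℚ) ∷ []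
  withoutZeroAnd (suc (suc (suc zero))) = (# 1 , # 2 , 1ℚ) ∷ (# 4 , # 5 , 1ℚ) ∷ (# 6 , # 7 , 1ℚ) ∷ []
  withoutZeroAnd (suc (suc (suc (suc zero)))) = (# 1 , # 5 , 1ℚ) ∷ (# 2 , # 6 , 1ℚ) ∷ (# 3 , # 7 , 1ℚ) ∷ []
  withoutZeroAnd (suc (suc (suc (suc (suc zero))))) = (# 1 , # 2 , 1ℚ) ∷ (# 3 , # 4 , 1ℚ) ∷ (# 6 , # 7 , 1ℚ) ∷ []
  withoutZeroAnd (suc (suc (suc (suc (suc (suc zero)))))) = (# 1 , # 2 , 1ℚ) ∷ (# 3 , # 7 , 1ℚ) ∷ (# 4 , # 5 , 1ℚ) ∷ []
  withoutZeroAnd (suc (suc (suc (suc (suc (suc (suc zero))))))) = (# 1 , # 5 , 1ℚ) ∷ (# 2 , # 6 , 1ℚ) ∷ (# 3 , # 4 , 1ℚ) ∷ []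

  -- G(8,4) is circulant, so rotating by a turns a matching of G − {0, b − a} into one of G − {a, b}
  without : Fin 8 → Fin 8 → Fin 8 → Fin 8 → ℚ
  without a b = fromEdges (map (λ (p , q , w) → rotate a p , rotate a q , w) (withoutZeroAnd ((8 + toℕ b ∸ toℕ a) mod 8)))

  without-one-certified : ∀ a → Certifies (without a a) (inj₁ a ∷ [])
  without-one-certified = toWitness {a? = all? λ a → certifies? (without a a) (inj₁ a ∷ [])} _

  without-two-certified : ∀ a b → Certifies (without a b) (inj₁ a ∷ inj₁ b ∷ [])
  without-two-certified = toWitness {a? = all? λ a → all? λ b → certifies? (without a b) (inj₁ a ∷ inj₁ b ∷ [])} _

  robust : Robust 3 G84
  robust [] _ _ = certified _ [] (perfectMatching-certified zero)
  robust (inj₁ a ∷ []) _ _ = certified _ _ (without-one-certified a)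
  robust (inj₁ a ∷ inj₁ b ∷ []) _ _ = certified _ _ (without-two-certified a b)
  robust (inj₂ (p , q) ∷ []) _ _ = perfectMatching-survives (avoiding c c) _ refl λ { (here refl) → proj₁ (avoiding-differs c c) ; (there ()) }
    where
    c : Fin 3
    c = colour p q
  robust (inj₂ (p , q) ∷ inj₂ (p′ , q′) ∷ []) _ _ = perfectMatching-survives (avoiding c c′) _ refl
    λ { (here refl) → proj₁ (avoiding-differs c c′) ; (there (here refl)) → proj₂ (avoiding-differs c c′) ; (there (there ())) }
    where
    c c′ : Fin 3
    c = colour p q
    c′ = colour p′ q′
  robust (inj₁ _ ∷ inj₂ _ ∷ []) _ (inj₁ (s≤s (s≤s (s≤s ()))))
  robust (inj₁ _ ∷ inj₂ _ ∷ []) _ (inj₂ count≢1) = ⊥-elim (count≢1 refl)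
  robust (inj₂ _ ∷ inj₁ _ ∷ []) _ (inj₁ (s≤s (s≤s (s≤s ()))))
  robust (inj₂ _ ∷ inj₁ _ ∷ []) _ (inj₂ count≢1) = ⊥-elim (count≢1 refl)
  robust (_ ∷ _ ∷ _ ∷ _) (s≤s (s≤s (s≤s ()))) _

module Degree where

  import Data.Nat.Properties as ℕ
  open import Data.Bool using (if_then_else_)
  open FinSum ℕ.+-0-commutativeMonoid using (sum)

  degree : ∀ {N} → (Fin N → Fin N → Bool) → Fin N → ℕ
  degree G v = sum (λ w → if G v w then 1 else 0)

module JoinGraph {k : ℕ} (G₀ G₁ : Fin k → Fin k → Bool) (π : Permutation′ k) where

  open import Data.Nat using (suc; _+_)
  import Data.Nat.Properties as ℕ
  open import Data.Fin using (splitAt; join)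
  open import Data.Fin.Properties using (_≟_; join-splitAt)
  open import Data.Fin.Permutation using (_⟨$⟩ʳ_; _⟨$⟩ˡ_; inverseˡ; inverseʳ)
  open import Data.Bool using (false; if_then_else_)
  open import Data.Sum using (inj₁; inj₂)
  open import Relation.Nullary using (yes; no; ⌊_⌋)
  open import Relation.Binary.PropositionalEquality
  open import Function using (Injective)
  open import Data.Empty using (⊥-elim)
  open import Defs using (_⊕[_]_)
  open FinSum ℕ.+-0-commutativeMonoid using (sum; sum-cong-≗; sum-splitAt; sum-single; if_≐_then_else_)

  φ ψ : Fin k → Fin k
  φ i = π ⟨$⟩ʳ i
  ψ j = π ⟨$⟩ˡ j

  open Join G₀ G₁ φ ψ (λ _ → inverseˡ π) (λ _ → inverseʳ π) public
  open Degree

  ⊕-splitAt : ∀ a b → (G₀ ⊕[ π ] G₁) a b ≡ joined (splitAt k a) (splitAt k b)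
  ⊕-splitAt a b with splitAt k a | splitAt k b
  ... | inj₁ i | inj₁ j = refl
  ... | inj₁ i | inj₂ j = refl
  ... | inj₂ j | inj₁ i = refl
  ... | inj₂ i | inj₂ j = refl

  splitAt-injective : Injective _≡_ _≡_ (splitAt k)
  splitAt-injective {a} {b} eq = trans (sym (join-splitAt k k a)) (trans (cong (join k k) eq) (join-splitAt k k b))

  ⊕-irreflexive : (∀ i → G₀ i i ≡ false) → (∀ i → G₁ i i ≡ false) → ∀ a → (G₀ ⊕[ π ] G₁) a a ≡ false
  ⊕-irreflexive irreflexive₀ irreflexive₁ a = trans (⊕-splitAt a a) (on-halves (splitAt k a))
    where
    on-halves : ∀ x → joined x x ≡ false
    on-halves (inj₁ i) = irreflexive₀ i
    on-halves (inj₂ i) = irreflexive₁ i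

  ⊕-symmetric : (∀ i j → G₀ i j ≡ G₀ j i) → (∀ i j → G₁ i j ≡ G₁ j i) → ∀ a b → (G₀ ⊕[ π ] G₁) a b ≡ (G₀ ⊕[ π ] G₁) b a
  ⊕-symmetric symmetric₀ symmetric₁ a b = trans (⊕-splitAt a b) (trans (on-halves (splitAt k a) (splitAt k b)) (sym (⊕-splitAt b a)))
    where
    on-halves : ∀ x y → joined x y ≡ joined y x
    on-halves (inj₁ i) (inj₁ j) = symmetric₀ i j
    on-halves (inj₂ i) (inj₂ j) = symmetric₁ i j
    on-halves (inj₁ i) (inj₂ j) = refl
    on-halves (inj₂ j) (inj₁ i) = refl

  ⊕-regular : ∀ {n} → (∀ i → degree G₀ i ≡ n) → (∀ j → degree G₁ j ≡ n) → ∀ a → degree (G₀ ⊕[ π ] G₁) a ≡ suc n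
  ⊕-regular {n} regular₀ regular₁ a = begin
    degree (G₀ ⊕[ π ] G₁) a                                          ≡⟨ sum-cong-≗ (λ b → cong (λ e → if e then 1 else 0) (⊕-splitAt a b)) ⟩
    sum (λ b → if joined (splitAt k a) (splitAt k b) then 1 else 0)  ≡⟨ sum-splitAt k (λ y → if joined (splitAt k a) y then 1 else 0) ⟩
    halves (splitAt k a)                                             ≡⟨ on-halves (splitAt k a) ⟩
    suc n                                                            ∎
    where
    open ≡-Reasoning
    halves : Vertex → ℕ
    halves x = sum (λ j → if joined x (inj₁ j) then 1 else 0) + sum (λ j → if joined x (inj₂ j) then 1 else 0)
    partner-count : ∀ i → sum (λ j → if ⌊ φ i ≟ j ⌋ then 1 else 0) ≡ 1
    partner-count i = trans (sum-cong-≗ flip≟) (sum-single (φ i) (λ _ → 1))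
      where
      flip≟ : ∀ j → (if ⌊ φ i ≟ j ⌋ then 1 else 0) ≡ (if j ≐ φ i then 1 else 0)
      flip≟ j with φ i ≟ j | j ≟ φ i
      ... | yes _ | yes _ = refl
      ... | no _ | no _ = refl
      ... | yes φi≡j | no j≢φi = ⊥-elim (j≢φi (sym φi≡j))
      ... | no φi≢j | yes j≡φi = ⊥-elim (φi≢j (sym j≡φi))
    on-halves : ∀ x → halves x ≡ suc n
    on-halves (inj₁ i) = trans (cong₂ _+_ (regular₀ i) (partner-count i)) (ℕ.+-comm n 1)
    on-halves (inj₂ j) = cong₂ _+_ (trans (sum-cong-≗ via-ψ) (sum-single (ψ j) (λ _ → 1))) (regular₁ j)
      where
      via-ψ : ∀ i → (if ⌊ φ i ≟ j ⌋ then 1 else 0) ≡ (if i ≐ ψ j then 1 else 0)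
      via-ψ i with φ i ≟ j | i ≟ ψ j
      ... | yes _ | yes _ = refl
      ... | no _ | no _ = refl
      ... | yes φi≡j | no i≢ψj = ⊥-elim (i≢ψj (φ≡⇒≡ψ φi≡j))
      ... | no φi≢j | yes i≡ψj = ⊥-elim (φi≢j (≡ψ⇒φ≡ i≡ψj))

module Star {N : ℕ} (G : Graph N) (symmetric : ∀ u v → G u v ≡ G v u) (irreflexive : ∀ v → G v v ≡ false) (v : Fin N) where

  open import Data.Nat using (zero; suc; _+_)
  import Data.Nat.Properties as ℕ
  open import Data.Fin using (zero; suc; toℕ)
  open import Data.Fin.Properties using (toℕ-injective)
  open import Data.Bool using (true; T; if_then_else_)
  open import Data.Unit using (tt)
  open import Data.Sum using (inj₁; inj₂)
  open import Data.Product using (_×_; _,_; ∃-syntax)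
  open import Data.List using (List; []; _∷_; length; tabulate)
  open import Data.List.Relation.Unary.Any using (Any; here; there)
  open import Data.List.Relation.Unary.All using (All; []; _∷_)
  import Data.List.Relation.Unary.All as All
  open import Data.List.Relation.Unary.AllPairs using ([]; _∷_)
  open import Data.List.Relation.Unary.Unique.Propositional using (Unique)
  open import Data.List.Membership.Propositional using (_∈_)
  open import Relation.Nullary using (yes; no)
  open import Data.Empty using (⊥-elim)
  open import Function using (_∘_)
  open import Defs using (Elem; IsEdgeElem; ElemIsEdge)
  open FinSum ℕ.+-0-commutativeMonoid using (sum)

  not-loop : ∀ {w} → T (G v w) → w ≢ v
  not-loop vw∈G refl = subst T (irreflexive v) vw∈G

  edgeTo : ∀ w → T (G v w) → Elem G
  edgeTo w vw∈G with toℕ v ℕ.<? toℕ w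
  ... | yes v<w = inj₂ ((v , w) , v<w , vw∈G)
  ... | no v≮w = inj₂ ((w , v) , ℕ.≤∧≢⇒< (ℕ.≮⇒≥ v≮w) (not-loop vw∈G ∘ toℕ-injective) , subst T (symmetric v w) vw∈G)

  edgeTo-joins : ∀ w vw∈G → ElemIsEdge (edgeTo w vw∈G) v w
  edgeTo-joins w vw∈G with toℕ v ℕ.<? toℕ w
  ... | yes _ = inj₁ (refl , refl)
  ... | no _ = inj₂ (refl , refl)

  edgeTo-isEdge : ∀ w vw∈G → IsEdgeElem (edgeTo w vw∈G)
  edgeTo-isEdge w vw∈G with toℕ v ℕ.<? toℕ w
  ... | yes _ = tt
  ... | no _ = tt

  other-endpoint-unique : ∀ {x w w′} → ElemIsEdge {G = G} x v w → ElemIsEdge x v w′ → w ≢ v → w ≡ w′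
  other-endpoint-unique {inj₂ _} (inj₁ (refl , refl)) (inj₁ (_ , refl)) _ = refl
  other-endpoint-unique {inj₂ _} (inj₁ (refl , refl)) (inj₂ (refl , refl)) _ = refl
  other-endpoint-unique {inj₂ _} (inj₂ (refl , refl)) (inj₁ (refl , refl)) w≢v = ⊥-elim (w≢v refl)
  other-endpoint-unique {inj₂ _} (inj₂ (refl , refl)) (inj₂ (refl , _)) _ = refl

  star : List (Fin N) → List (Elem G)
  star-step : ∀ w b → G v w ≡ b → List (Fin N) → List (Elem G)
  star [] = []
  star (w ∷ ws) = star-step w (G v w) refl ws
  star-step w true vw ws = edgeTo w (subst T (sym vw) tt) ∷ star ws
  star-step w false _ ws = star ws

  star-edges : ∀ ws → All IsEdgeElem (star ws)
  star-edges [] = []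
  star-edges (w ∷ ws) = step (G v w) refl
    where
    step : ∀ b (vw : G v w ≡ b) → All IsEdgeElem (star-step w b vw ws)
    step true vw = edgeTo-isEdge w _ ∷ star-edges ws
    step false _ = star-edges ws

  star-covers : ∀ ws {w} → w ∈ ws → T (G v w) → Any (λ x → ElemIsEdge x v w) (star ws)
  star-covers (w′ ∷ ws) {w} w∈ vw∈G = step (G v w′) refl w∈
    where
    step : ∀ b (vw′ : G v w′ ≡ b) → w ∈ w′ ∷ ws → Any (λ x → ElemIsEdge x v w) (star-step w′ b vw′ ws)
    step true _ (here refl) = here (edgeTo-joins w′ _)
    step true _ (there w∈) = there (star-covers ws w∈ vw∈G)
    step false vw′ (here refl) = ⊥-elim (subst T vw′ vw∈G)
    step false _ (there w∈) = star-covers ws w∈ vw∈G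

  star-member : ∀ ws {x} → x ∈ star ws → ∃[ w ] (w ∈ ws × ElemIsEdge x v w × w ≢ v)
  star-member (w ∷ ws) {x} x∈ = step (G v w) refl x∈
    where
    later : x ∈ star ws → ∃[ w′ ] (w′ ∈ w ∷ ws × ElemIsEdge x v w′ × w′ ≢ v)
    later x∈ with star-member ws x∈
    ... | w′ , w′∈ , joins , w′≢v = w′ , there w′∈ , joins , w′≢v
    step : ∀ b (vw : G v w ≡ b) → x ∈ star-step w b vw ws → ∃[ w′ ] (w′ ∈ w ∷ ws × ElemIsEdge x v w′ × w′ ≢ v)
    step true vw (here refl) = w , here refl , edgeTo-joins w _ , not-loop (subst T (sym vw) tt)
    step true _ (there x∈) = later x∈
    step false _ x∈ = later x∈

  star-unique : ∀ ws → Unique ws → Unique (star ws)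
  star-unique [] [] = []
  star-unique (w ∷ ws) (w∉ws ∷ unique) = step (G v w) refl
    where
    step : ∀ b (vw : G v w ≡ b) → Unique (star-step w b vw ws)
    step true vw = All.tabulate fresh ∷ star-unique ws unique
      where
      fresh : ∀ {x} → x ∈ star ws → edgeTo w (subst T (sym vw) tt) ≢ x
      fresh x∈ refl with star-member ws x∈
      ... | w′ , w′∈ , joins , w′≢v =
        All.lookup w∉ws (subst (_∈ ws) (sym (other-endpoint-unique (edgeTo-joins w _) joins (not-loop (subst T (sym vw) tt)))) w′∈) refl
    step false _ = star-unique ws unique

  star-length : ∀ {M} (f : Fin M → Fin N) → length (star (tabulate f)) ≡ sum (λ i → if G v (f i) then 1 else 0)
  star-length {zero} f = refl
  star-length {suc M} f = step (G v (f zero)) refl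
    where
    step : ∀ b (vw : G v (f zero) ≡ b) → length (star-step (f zero) b vw (tabulate (f ∘ suc))) ≡ (if b then 1 else 0) + sum (λ i → if G v (f (suc i)) then 1 else 0)
    step true _ = cong suc (star-length (f ∘ suc))
    step false _ = star-length (f ∘ suc)

open import Data.Nat using (_≤_)

module JoinRobustness {k : ℕ} (G₀ G₁ : Fin k → Fin k → Bool) (φ ψ : Fin k → Fin k)
                      (ψ∘φ : ∀ i → ψ (φ i) ≡ i) (φ∘ψ : ∀ j → φ (ψ j) ≡ j) (irreflexive₀ : ∀ i → G₀ i i ≡ false)
                      {m : ℕ} (3≤m : 3 ≤ m) (robust₀ : Faults.Robust m G₀) (robust₁ : Faults.Robust m G₁) where

  open import Data.Nat using (suc; _+_; _<_; z≤n; s≤s)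
  import Data.Nat.Properties as ℕ
  open import Data.Fin.Properties using (_≟_)
  open import Data.Bool using (T)
  open import Data.Sum using (_⊎_; inj₁; inj₂; [_,_]′)
  import Data.Sum.Properties as Sum
  open import Data.Product using (Σ-syntax; _×_; _,_; proj₁; proj₂)
  import Data.Product.Properties as Product
  open import Data.List using (List; []; _∷_; length)
  open import Data.List.Relation.Unary.Any using (here; there)
  open import Data.List.Membership.Propositional using (_∈_)
  open import Data.List.Relation.Binary.Permutation.Propositional using (_↭_)
  open import Data.List.Relation.Binary.Permutation.Propositional.Properties using (↭-length)
  open import Data.Rational using (0ℚ)
  open import Data.Rational.Properties using () renaming (_≟_ to _≟ℚ_)
  open import Function.Construct.Identity using (⇔-id)
  open import Relation.Nullary using (¬_; yes; no)
  open import Data.Empty using (⊥-elim)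
  open import Function using (_∘_; mk⇔; Equivalence)
  open Matching
  open Rational using (sum)
  open Faults
  open SideFaults
  open Join G₀ G₁ φ ψ ψ∘φ φ∘ψ
  open import Data.List.Membership.DecPropositional (Sum.≡-dec (_≟_ {k}) (Product.≡-dec (_≟_ {k}) (_≟_ {k}))) using (_∈?_)

  intact-unless : ∀ {E₁ Ec} (Δ : Deletion Vertex) → Δ ∘ᵈ inj₂ ≼ deletion E₁ → (∀ {i j} → edge Δ (inj₁ i) (inj₂ j) → (i , j) ∈ Ec)
    → ∀ {w} → ¬ (w , φ w) ∈ Ec → ¬ inj₁ (φ w) ∈ E₁ → CrossIntact Δ w
  intact-unless Δ right cross ∉Ec ∉E₁ = ∉Ec ∘ cross , ∉E₁ ∘ Equivalence.to (_≼_.same-vertices right _)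

  one-damaged-partner : ∀ {Δ : Deletion Vertex} (E₁ : List (Fault (Fin k))) (Ec : List (Fin k × Fin k))
    → length E₁ + length Ec ≤ 1 → Δ ∘ᵈ inj₂ ≼ deletion E₁ → (∀ {i j} → edge Δ (inj₁ i) (inj₂ j) → (i , j) ∈ Ec)
    → Fin k → Σ[ w₀ ∈ Fin k ] (∀ w → w ≢ w₀ → CrossIntact Δ w)
  one-damaged-partner {Δ} [] [] _ right cross x = x , λ w _ → intact-unless Δ right cross (λ ()) (λ ())
  one-damaged-partner {Δ} [] ((a , b) ∷ []) _ right cross x =
    a , λ w w≢a → intact-unless Δ right cross (λ { (here eq) → w≢a (proj₁ (Product.,-injective eq)) ; (there ()) }) (λ ())
  one-damaged-partner {Δ} (inj₁ y ∷ []) [] _ right cross x =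
    ψ y , λ w w≢ψy → intact-unless Δ right cross (λ ()) (λ { (here eq) → w≢ψy (φ≡⇒≡ψ (Sum.inj₁-injective eq)) ; (there ()) })
  one-damaged-partner {Δ} (inj₂ e ∷ []) [] _ right cross x =
    x , λ w _ → intact-unless Δ right cross (λ ()) (λ { (here ()) ; (there ()) })
  one-damaged-partner [] (_ ∷ _ ∷ _) (s≤s ()) _ _ _
  one-damaged-partner (_ ∷ []) (_ ∷ _) (s≤s ()) _ _ _
  one-damaged-partner (_ ∷ _ ∷ _) _ (s≤s ()) _ _ _

  intact₁ : FPM sum G₁ (deletion [])
  intact₁ = robust₁ [] (ℕ.≤-trans (s≤s z≤n) 3≤m) (inj₁ (ℕ.≤-trans (s≤s (s≤s z≤n)) 3≤m))

  minus-partner : ∀ {Δ₁ : Deletion (Fin k)} {D₁} y → Δ₁ ≼ deletion D₁ → length D₁ ≤ 1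
    → suc (suc (length D₁)) < m ⊎ countVertices (inj₁ y ∷ D₁) ≢ 1 → FPM sum G₁ (Δ₁ +ᵛ y)
  minus-partner {D₁ = D₁} y Δ₁≼ l≤1 condition =
    weaken (≼-trans (+ᵛ-mono Δ₁≼) deletion-+ᵛ) (robust₁ (inj₁ y ∷ D₁) (ℕ.≤-trans (s≤s (s≤s l≤1)) 3≤m) condition)

  remainder≤ : ∀ a b c d → a + b + c ≤ d + a → b + c ≤ d
  remainder≤ a b c d le = ℕ.+-cancelˡ-≤ a _ _ (subst₂ _≤_ (ℕ.+-assoc a b c) (ℕ.+-comm d a) le)

  module _ (DW : List (Fault Vertex)) where

    private
      Δ : Deletion Vertex
      Δ = deletion DW
      D₀ D₁ : List (Fault (Fin k))
      D₀ = leftFaults DW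
      D₁ = rightFaults DW
      Dc : List (Fin k × Fin k)
      Dc = crossFaults DW
      left₀ : Δ ∘ᵈ inj₁ ≼ deletion D₀
      left₀ = left-restriction DW
      right₁ : Δ ∘ᵈ inj₂ ≼ deletion D₁
      right₁ = right-restriction DW
      length≡ : length D₀ + length D₁ + length Dc ≡ length DW
      length≡ = length-sides DW

    spare-left : suc (suc (length D₀)) ≤ m → length D₁ ≤ length D₀ → FPM ∑ʲ joined Δ
    spare-left l₀+2≤m l₁≤l₀ = glue (weaken left₀ M₀) (weaken right₁ M₁)
      where
      M₀ : FPM sum G₀ (deletion D₀)
      M₀ = robust₀ D₀ (ℕ.<⇒≤ l₀+2≤m) (inj₁ l₀+2≤m)
      M₁ : FPM sum G₁ (deletion D₁)
      M₁ = robust₁ D₁ (ℕ.≤-<-trans l₁≤l₀ (ℕ.<⇒≤ l₀+2≤m)) (inj₁ (ℕ.≤-trans (s≤s (s≤s l₁≤l₀)) l₀+2≤m))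

    rest≤1 : suc (length D₀) ≡ m → length DW ≤ m → length D₁ + length Dc ≤ 1
    rest≤1 l₀+1≡m l≤m = remainder≤ (length D₀) (length D₁) (length Dc) 1 (subst₂ _≤_ (sym length≡) (sym l₀+1≡m) l≤m)

    -- with only one fault left for the right side, deleting a further vertex there is harmless
    partner-tolerable : suc (length D₀) ≡ m → length D₁ ≤ 1 → Tolerable m DW → countVertices D₀ ≡ 1
      → ∀ y → suc (suc (length D₁)) < m ⊎ countVertices (inj₁ y ∷ D₁) ≢ 1
    partner-tolerable l₀+1≡m l₁≤1 tolerable count₀≡1 y = by-length (length D₁) refl tolerable
      where
      by-length : ∀ n → length D₁ ≡ n → Tolerable m DW → suc (suc (length D₁)) < m ⊎ countVertices (inj₁ y ∷ D₁) ≢ 1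
      by-length 0 l₁≡0 _ = inj₁ (subst (λ l → suc (suc l) < m) (sym l₁≡0) 3≤m)
      by-length (suc _) _ (inj₂ (inj₂ 4≤m)) = inj₁ (ℕ.≤-trans (s≤s (s≤s (s≤s l₁≤1))) 4≤m)
      by-length (suc _) _ (inj₂ (inj₁ count≢1)) =
        inj₂ (λ count₁+1≡1 → count≢1 (trans (sym (countVertices-sides DW)) (cong₂ _+_ count₀≡1 (ℕ.suc-injective count₁+1≡1))))
      by-length (suc n) l₁≡ (inj₁ l<m) = ⊥-elim (ℕ.<-irrefl refl (ℕ.<-≤-trans l<m (subst₂ _≤_ l₀+1≡m length≡ too-long)))
        where
        too-long : suc (length D₀) ≤ length D₀ + length D₁ + length Dc
        too-long = ℕ.≤-trans (subst₂ _≤_ (ℕ.+-comm (length D₀) 1) (cong (length D₀ +_) (sym l₁≡)) (ℕ.+-monoʳ-≤ (length D₀) (s≤s z≤n)))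
                             (ℕ.m≤m+n _ _)

    tight-left : suc (length D₀) ≡ m → length DW ≤ m → Tolerable m DW → FPM ∑ʲ joined Δ
    tight-left l₀+1≡m l≤m tolerable with countVertices D₀ ℕ.≟ 1
    ... | no count₀≢1 = glue (weaken left₀ M₀) (weaken right₁ M₁)
      where
      l₁≤1 : length D₁ ≤ 1
      l₁≤1 = ℕ.m+n≤o⇒m≤o (length D₁) (rest≤1 l₀+1≡m l≤m)
      M₀ : FPM sum G₀ (deletion D₀)
      M₀ = robust₀ D₀ (ℕ.≤-reflexive l₀+1≡m) (inj₂ count₀≢1)
      M₁ : FPM sum G₁ (deletion D₁)
      M₁ = robust₁ D₁ (ℕ.≤-<-trans l₁≤1 (ℕ.≤-trans (s≤s (s≤s z≤n)) 3≤m)) (inj₁ (ℕ.≤-trans (s≤s (s≤s l₁≤1)) 3≤m))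
    ... | yes count₀≡1 with extractVertex D₀ (ℕ.≤-reflexive (sym count₀≡1))
    ... | x , D₀′ , D₀↭ , count≡ = vertex-defect irreflexive₀ M₀ x x∉E₀ left partner-matching intact
      where
      l₁≤1 : length D₁ ≤ 1
      l₁≤1 = ℕ.m+n≤o⇒m≤o (length D₁) (rest≤1 l₀+1≡m l≤m)
      count₀′≡0 : countVertices D₀′ ≡ 0
      count₀′≡0 = ℕ.suc-injective (trans (sym count≡) count₀≡1)
      damaged : Σ[ w₀ ∈ Fin k ] (∀ w → w ≢ w₀ → CrossIntact Δ w)
      damaged = one-damaged-partner {Δ} D₁ Dc (rest≤1 l₀+1≡m l≤m) right₁ (cross-deleted DW) x
      w₀ : Fin k
      w₀ = proj₁ damaged
      -- x is reinstated, but its edge to the only partner w₀ whose cross edge may be damaged is deleted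
      E₀ : List (Fault (Fin k))
      E₀ = inj₂ (x , w₀) ∷ D₀′
      M₀ : FPM sum G₀ (deletion E₀)
      M₀ = robust₀ E₀ (subst (_< m) (↭-length D₀↭) (ℕ.≤-reflexive l₀+1≡m)) (inj₂ (subst (_≢ 1) (sym count₀′≡0) ℕ.0≢1+n))
      x∉E₀ : ¬ inj₁ x ∈ E₀
      x∉E₀ (there x∈D₀′) = no-vertex-faults D₀′ count₀′≡0 x∈D₀′
      left : Δ ∘ᵈ inj₁ ≼ deletion E₀ +ᵛ x
      left = ≼-trans left₀ (≼-trans (deletion-↭ D₀↭) (≼-trans deletion-vertex∷ (+ᵛ-mono deletion-∷edge)))
      partner-matching : ∀ w → FPM sum G₁ (Δ ∘ᵈ inj₂ +ᵛ φ w)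
      partner-matching w = minus-partner (φ w) right₁ l₁≤1 (partner-tolerable l₀+1≡m l₁≤1 tolerable count₀≡1 (φ w))
      intact : ∀ w → weight M₀ x w ≢ 0ℚ → CrossIntact Δ w
      intact w g≢0 = proj₂ damaged w λ { refl → proj₂ (proj₂ (proj₂ (weight-supp M₀ x w g≢0))) (inj₁ (here refl)) }

    full-left : length D₀ ≡ m → length DW ≤ m → FPM ∑ʲ joined Δ
    full-left l₀≡m l≤m with removable D₀ (subst (3 ≤_) (sym l₀≡m) 3≤m)
    ... | f , D₀′ , D₀↭ , count₀′≢1 = by-fault f D₀↭
      where
      rest≡0 : length D₁ + length Dc ≡ 0
      rest≡0 = ℕ.n≤0⇒n≡0 (remainder≤ (length D₀) (length D₁) (length Dc) 0 (subst₂ _≤_ (sym length≡) (sym l₀≡m) l≤m))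
      l₁≡0 : length D₁ ≡ 0
      l₁≡0 = ℕ.m+n≡0⇒m≡0 _ rest≡0
      empty : ∀ {A : Set} {a : A} (xs : List A) → length xs ≡ 0 → ¬ a ∈ xs
      empty [] _ ()
      right-clean : Δ ∘ᵈ inj₂ ≼ deletion []
      right-clean = record
        { same-vertices = λ y → mk⇔ (⊥-elim ∘ empty D₁ l₁≡0 ∘ Equivalence.to (_≼_.same-vertices right₁ y)) λ ()
        ; fewer-edges = ⊥-elim ∘ [ empty D₁ l₁≡0 , empty D₁ l₁≡0 ]′ ∘ _≼_.fewer-edges right₁ }
      all-intact : ∀ w → CrossIntact Δ w
      all-intact w = empty Dc (ℕ.m+n≡0⇒n≡0 (length D₁) rest≡0) ∘ cross-deleted DW ,
                     empty [] refl ∘ Equivalence.to (_≼_.same-vertices right-clean (φ w))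
      M₀ : FPM sum G₀ (deletion D₀′)
      M₀ = robust₀ D₀′ (ℕ.≤-reflexive (trans (sym (↭-length D₀↭)) l₀≡m)) (inj₂ count₀′≢1)
      M₁ : FPM sum G₁ (Δ ∘ᵈ inj₂)
      M₁ = weaken right-clean intact₁
      by-fault : ∀ f → D₀ ↭ f ∷ D₀′ → FPM ∑ʲ joined Δ
      by-fault (inj₁ x) D₀↭ with inj₁ x ∈? D₀′
      ... | yes x∈D₀′ = glue (weaken (≼-trans left₀ (≼-trans (deletion-↭ D₀↭) (deletion-duplicate x∈D₀′))) M₀) M₁
      ... | no x∉D₀′ = vertex-defect irreflexive₀ M₀ x x∉D₀′ (≼-trans left₀ (≼-trans (deletion-↭ D₀↭) deletion-vertex∷))
                         (λ w → minus-partner (φ w) right-clean z≤n (inj₁ 3≤m)) (λ w _ → all-intact w)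
      by-fault (inj₂ (u , v)) D₀↭ with u ≟ v
      ... | yes refl = glue (weaken (≼-trans left₀ (≼-trans (deletion-↭ D₀↭) deletion-edge∷)) M₀-loop) M₁
        where
        loop-unused : weight M₀ u u ≡ 0ℚ
        loop-unused with weight M₀ u u ≟ℚ 0ℚ
        ... | yes w≡0 = w≡0
        ... | no w≢0 = ⊥-elim (subst T (irreflexive₀ u) (proj₁ (weight-supp M₀ u u w≢0)))
        M₀-loop : FPM sum G₀ (deletion D₀′ +ᵉ (u , u))
        M₀-loop = delete-unused-edges M₀ (λ _ → ⇔-id _) λ { (inj₁ uu∈D₀′) → inj₁ uu∈D₀′ ; (inj₂ (inj₁ (refl , refl))) → inj₂ loop-unused
                                                          ; (inj₂ (inj₂ (refl , refl))) → inj₂ loop-unused }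
      ... | no u≢v = edge-defect M₀ u v u≢v (≼-trans left₀ (≼-trans (deletion-↭ D₀↭) deletion-edge∷)) minus-partners M₁
                       (λ _ → all-intact u , all-intact v)
        where
        minus-partners : FPM sum G₁ (Δ ∘ᵈ inj₂ +ᵛ φ u +ᵛ φ v)
        minus-partners = weaken (≼-trans (+ᵛ-mono (+ᵛ-mono right-clean)) (≼-trans (+ᵛ-mono deletion-+ᵛ) deletion-+ᵛ))
                                (robust₁ (inj₁ (φ v) ∷ inj₁ (φ u) ∷ []) 3≤m (inj₂ λ ()))

    left-heavy : length DW ≤ m → Tolerable m DW → length D₁ ≤ length D₀ → FPM ∑ʲ joined Δ
    left-heavy l≤m tolerable l₁≤l₀ with ℕ.m≤n⇒m<n∨m≡n l₀≤m
      where
      l₀≤m : length D₀ ≤ m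
      l₀≤m = ℕ.m+n≤o⇒m≤o (length D₀) (ℕ.m+n≤o⇒m≤o (length D₀ + length D₁) (subst (_≤ m) (sym length≡) l≤m))
    ... | inj₂ l₀≡m = full-left l₀≡m l≤m
    ... | inj₁ l₀<m with ℕ.m≤n⇒m<n∨m≡n l₀<m
    ...   | inj₁ l₀+1<m = spare-left l₀+1<m l₁≤l₀
    ...   | inj₂ l₀+1≡m = tight-left l₀+1≡m l≤m tolerable

module JoinStep {k : ℕ} (G₀ G₁ : Fin k → Fin k → Bool) (π : Permutation′ k)
                (irreflexive₀ : ∀ i → G₀ i i ≡ false) (irreflexive₁ : ∀ i → G₁ i i ≡ false)
                {m : ℕ} (3≤m : 3 ≤ m) (robust₀ : Faults.Robust m G₀) (robust₁ : Faults.Robust m G₁) where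

  open import Data.Nat using (suc; s≤s)
  import Data.Nat.Properties as ℕ
  open import Data.Fin using (splitAt)
  open import Data.Fin.Permutation using (inverseˡ; inverseʳ)
  open import Data.Bool using (T)
  open import Data.Sum using (inj₁; inj₂; swap)
  open import Data.List using (List; length; map)
  open import Data.List.Properties using (length-map)
  open import Data.Rational.Properties using (+-comm)
  open import Relation.Nullary using (yes; no)
  open import Relation.Nullary.Decidable using (toWitness; fromWitness)
  open import Function using (_∘_)
  open import Defs using (_⊕[_]_)
  open Matching
  open Rational using (sum; sum-splitAt)
  open Faults
  open SideFaults

  open JoinGraph G₀ G₁ π
  private
    module Swapped = Join G₁ G₀ ψ φ (λ _ → inverseʳ π) (λ _ → inverseˡ π)
    module Heavy₀ = JoinRobustness G₀ G₁ φ ψ (λ _ → inverseˡ π) (λ _ → inverseʳ π) irreflexive₀ 3≤m robust₀ robust₁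
    module Heavy₁ = JoinRobustness G₁ G₀ ψ φ (λ _ → inverseʳ π) (λ _ → inverseˡ π) irreflexive₁ 3≤m robust₁ robust₀

  swap-joined : ∀ a b → T (Swapped.joined (swap a) (swap b)) → T (joined a b)
  swap-joined (inj₁ i) (inj₁ j) ij∈G = ij∈G
  swap-joined (inj₂ i) (inj₂ j) ij∈G = ij∈G
  swap-joined (inj₁ i) (inj₂ j) ψj≡i = fromWitness (≡ψ⇒φ≡ (sym (toWitness ψj≡i)))
  swap-joined (inj₂ j) (inj₁ i) ψj≡i = fromWitness (≡ψ⇒φ≡ (sym (toWitness ψj≡i)))

  join-tolerates : ∀ DW → length DW ≤ m → Tolerable m DW → FPM ∑ʲ joined (deletion DW)
  join-tolerates DW l≤m tolerable with length (rightFaults DW) ℕ.≤? length (leftFaults DW)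
  ... | yes r≤l = Heavy₀.left-heavy DW l≤m tolerable r≤l
  ... | no r≰l = pullback swap (λ h → +-comm (sum (h ∘ inj₂)) (sum (h ∘ inj₁))) swap-joined
                   (deletion-map swap swap-injective DW)
                   (Heavy₁.left-heavy (map swapFault DW) (subst (_≤ m) (sym length≡) l≤m)
                                      (Tolerable-resp {D = DW} {D′ = map swapFault DW} (sym length≡) (sym count≡) tolerable) swapped-heavy)
    where
    length≡ : length (map swapFault DW) ≡ length DW
    length≡ = length-map swapFault DW
    count≡ : countVertices (map swapFault DW) ≡ countVertices DW
    count≡ = countVertices-map swap DW
    swapped-heavy : length (rightFaults (map swapFault DW)) ≤ length (rightFaults DW)
    swapped-heavy = subst (_≤ length (rightFaults DW)) (sym (cong length (rightFaults-swap DW))) (ℕ.<⇒≤ (ℕ.≰⇒> r≰l))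

  join-survives : ∀ D → length D ≤ m → Tolerable m D → FPM sum (G₀ ⊕[ π ] G₁) (deletion D)
  join-survives D l≤m tolerable =
    pullback (splitAt k) (sum-splitAt k) (λ a b → subst T (sym (⊕-splitAt a b))) (deletion-map (splitAt k) splitAt-injective D)
      (join-tolerates DW (subst (_≤ m) (sym length≡) l≤m) (Tolerable-resp {D = D} {D′ = DW} (sym length≡) (sym count≡) tolerable))
    where
    DW : List (Fault Vertex)
    DW = map (mapFault (splitAt k)) D
    length≡ : length DW ≡ length D
    length≡ = length-map (mapFault (splitAt k)) D
    count≡ : countVertices DW ≡ countVertices D
    count≡ = countVertices-map (splitAt k) D

  join-robust : Robust (suc m) (G₀ ⊕[ π ] G₁)
  join-robust D (s≤s l≤m) (inj₁ (s≤s l<m)) = join-survives D l≤m (inj₁ l<m)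
  join-robust D (s≤s l≤m) (inj₂ count≢1) = join-survives D l≤m (inj₂ (inj₁ count≢1))

module RestrictedHL where

  open import Data.Nat using (ℕ; zero; _≤_; _<_; s≤s)
  import Data.Nat.Properties as ℕ
  open import Data.Fin using (Fin; zero; _↑ˡ_)
  open import Data.Fin.Properties using (all?)
  open import Data.Bool using (false)
  import Data.Bool.Properties as Bool
  open import Data.Sum using (inj₂)
  open import Data.List using (length)
  open import Relation.Nullary.Decidable using (toWitness)
  open import Relation.Binary.PropositionalEquality
  open import Defs
  open Matching using (FPM)
  open Rational using (sum)
  open Faults
  open Degree

  irreflexive : ∀ {n N G} → RHL n N G → ∀ v → G v v ≡ false
  irreflexive rhl0 = toWitness {a? = all? λ v → K1 v v Bool.≟ false} _
  irreflexive rhl1 = toWitness {a? = all? λ v → K2 v v Bool.≟ false} _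
  irreflexive rhl2 = toWitness {a? = all? λ v → C4 v v Bool.≟ false} _
  irreflexive rhl3 = toWitness {a? = all? λ v → G84 v v Bool.≟ false} _
  irreflexive (rhlS _ r₀ r₁ π) = JoinGraph.⊕-irreflexive _ _ π (irreflexive r₀) (irreflexive r₁)

  symmetric : ∀ {n N G} → RHL n N G → ∀ u v → G u v ≡ G v u
  symmetric rhl0 = toWitness {a? = all? λ u → all? λ v → K1 u v Bool.≟ K1 v u} _
  symmetric rhl1 = toWitness {a? = all? λ u → all? λ v → K2 u v Bool.≟ K2 v u} _
  symmetric rhl2 = toWitness {a? = all? λ u → all? λ v → C4 u v Bool.≟ C4 v u} _
  symmetric rhl3 = toWitness {a? = all? λ u → all? λ v → G84 u v Bool.≟ G84 v u} _
  symmetric (rhlS _ r₀ r₁ π) = JoinGraph.⊕-symmetric _ _ π (symmetric r₀) (symmetric r₁)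

  regular : ∀ {n N G} → RHL n N G → ∀ v → degree G v ≡ n
  regular rhl0 = toWitness {a? = all? λ v → degree K1 v ℕ.≟ 0} _
  regular rhl1 = toWitness {a? = all? λ v → degree K2 v ℕ.≟ 1} _
  regular rhl2 = toWitness {a? = all? λ v → degree C4 v ℕ.≟ 2} _
  regular rhl3 = toWitness {a? = all? λ v → degree G84 v ℕ.≟ 3} _
  regular (rhlS _ r₀ r₁ π) = JoinGraph.⊕-regular _ _ π (regular r₀) (regular r₁)

  robust : ∀ {n N G} → RHL n N G → 3 ≤ n → Robust n G
  robust rhl1 (s≤s ())
  robust rhl2 (s≤s (s≤s ()))
  robust rhl3 _ = BaseCase.robust
  robust (rhlS 3≤m r₀ r₁ π) _ = JoinStep.join-robust _ _ π (irreflexive r₀) (irreflexive r₁) 3≤m (robust r₀ 3≤m) (robust r₁ 3≤m)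

  survives : ∀ {n N G} → RHL n N G → 5 ≤ n → ∀ D → length D < n → FPM sum G (deletion D)
  survives rhl2 (s≤s (s≤s ()))
  survives rhl3 (s≤s (s≤s (s≤s ())))
  survives (rhlS 3≤m r₀ r₁ π) (s≤s 4≤m) D (s≤s l≤m) =
    JoinStep.join-survives _ _ π (irreflexive r₀) (irreflexive r₁) 3≤m (robust r₀ 3≤m) (robust r₁ 3≤m) D l≤m (inj₂ (inj₂ 4≤m))

  vertex : ∀ {n N G} → RHL n N G → Fin N
  vertex rhl0 = zero
  vertex rhl1 = zero
  vertex rhl2 = zero
  vertex rhl3 = zero
  vertex (rhlS {k = k} _ r₀ _ _) = vertex r₀ ↑ˡ k

module Translation where

  open import Data.Fin using (Fin)
  open import Data.Sum using (inj₁; inj₂)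
  open import Data.Product using (_,_)
  open import Data.List using (List; map)
  open import Data.List.Relation.Unary.Any using (Any; here; there)
  open import Data.List.Membership.Propositional.Properties using (∈-map⁺; ∈-map⁻)
  open import Data.Rational using (0ℚ; 1ℚ)
  open import Data.Rational.Properties using () renaming (_≟_ to _≟ℚ_)
  open import Data.Bool using (T)
  open import Data.Empty using (⊥-elim)
  open import Relation.Nullary using (¬_; yes; no)
  open import Relation.Binary.PropositionalEquality
  open import Function using (_∘_)
  import Data.Sum as Sum
  open import Defs
  open Matching
  open Rational using (sum; foldr-allFin; sum-cong-≗; sum-zero)
  open Faults

  forget : ∀ {N} {G : Graph N} → Elem G → Fault (Fin N)
  forget (inj₁ v) = inj₁ v
  forget (inj₂ ((u , v) , _)) = inj₂ (u , v)

  module _ {N} {G : Graph N} (F : List (Elem G)) where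

    forget-vertex : ∀ {v} → VertexDeleted G F v → vertex (deletion (map forget F)) v
    forget-vertex = ∈-map⁺ forget

    remember-vertex : ∀ {v} → vertex (deletion (map forget F)) v → VertexDeleted G F v
    remember-vertex v∈ with ∈-map⁻ forget v∈
    ... | inj₁ _ , v∈F , refl = v∈F

    forget-edge : ∀ {xs : List (Elem G)} {u v} → Any (λ x → ElemIsEdge x u v) xs → edge (deletion (map forget xs)) u v
    forget-edge (here {inj₂ _} (inj₁ (refl , refl))) = inj₁ (here refl)
    forget-edge (here {inj₂ _} (inj₂ (refl , refl))) = inj₂ (here refl)
    forget-edge (there uv∈) = Sum.map there there (forget-edge uv∈)

    toHasFPM : FPM sum G (deletion (map forget F)) → HasFPM G F
    toHasFPM M = weight M , weight-sym M , supp , (λ u v → weight-nonneg M u v , weight≤1 M u v) , saturated′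
      where
      supp : ∀ u v → weight M u v ≢ 0ℚ → RemEdge G F u v
      supp u v w≢0 with weight-supp M u v w≢0
      ... | uv∈G , u∉ , v∉ , uv∉ = uv∈G , u∉ ∘ forget-vertex , v∉ ∘ forget-vertex , uv∉ ∘ forget-edge
      saturated′ : ∀ v → ¬ VertexDeleted G F v → Σℚ G F (weight M v) ≡ 1ℚ
      saturated′ v v∉ = trans (foldr-allFin (weight M v)) (saturated M v (v∉ ∘ remember-vertex))

  isolated : ∀ {N} (G : Graph N) (F : List (Elem G)) v → ¬ VertexDeleted G F v
    → (∀ w → T (G v w) → EdgeDeleted G F v w) → ¬ HasFPM G F
  isolated {N} G F v v∉F covered (g , _ , supp , _ , saturated) = 0≢1 (trans (sym row≡0) (saturated v v∉F))
    where
    unused : ∀ w → g v w ≡ 0ℚ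
    unused w with g v w ≟ℚ 0ℚ
    ... | yes g≡0 = g≡0
    ... | no g≢0 with supp v w g≢0
    ... | vw∈G , _ , _ , vw∉F = ⊥-elim (vw∉F (covered w vw∈G))
    row≡0 : Σℚ G F (g v) ≡ 0ℚ
    row≡0 = trans (foldr-allFin (g v)) (trans (sum-cong-≗ unused) (sum-zero N))
    0≢1 : 0ℚ ≢ 1ℚ
    0≢1 ()

module Bounds where

  open import Data.Nat using (ℕ; _≤_; _<_)
  open import Data.Product using (_×_; _,_; Σ-syntax)
  open import Data.List using (List; allFin; length; map)
  open import Data.List.Properties using (length-map)
  open import Data.List.Relation.Unary.All using (All)
  import Data.List.Relation.Unary.All as All
  open import Data.List.Relation.Unary.Unique.Propositional using (Unique)
  open import Data.List.Relation.Unary.Unique.Propositional.Properties using (allFin⁺)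
  open import Data.List.Membership.Propositional.Properties using (∈-allFin)
  open import Relation.Nullary using (¬_)
  open import Function using (id)
  open import Defs
  open RestrictedHL
  open Translation

  star-cut : ∀ {n N G} → RHL n N G → Σ[ F ∈ List (Elem G) ] (All IsEdgeElem F × Unique F × length F ≡ n × ¬ HasFPM G F)
  star-cut {N = N} {G} r = star (allFin N) , edges , star-unique (allFin N) (allFin⁺ N) , trans (star-length id) (regular r (vertex r)) ,
                           isolated G (star (allFin N)) (vertex r) (All.lookup edges) (λ w → star-covers (allFin N) (∈-allFin w))
    where
    open Star G (symmetric r) (irreflexive r) (vertex r)
    edges : All IsEdgeElem (star (allFin N))
    edges = star-edges (allFin N)

  small-cuts-fail : ∀ {n N G} → RHL n N G → 5 ≤ n → ∀ F → length F < n → HasFPM G F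
  small-cuts-fail {n} r 5≤n F l<n = toHasFPM F (survives r 5≤n (map forget F) (subst (_< n) (sym (length-map forget F)) l<n))

open import Defs
open import Data.Nat using (ℕ; _≤_)
open import Data.Product using (_×_; _,_)
open Bounds

theorem4p4 : (n N : ℕ) (G : Graph N) → 5 ≤ n → RHL n N G → IsFsmp G n × IsFmp G n
theorem4p4 n N G 5≤n r with star-cut r
... | F , edges , unique , length≡n , ¬fpm =
  ((F , unique , length≡n , ¬fpm) , λ F′ _ → small-cuts-fail r 5≤n F′) ,
  ((F , edges , unique , length≡n , ¬fpm) , λ F′ _ _ → small-cuts-fail r 5≤n F′)
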